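{- Let $p$ be a constant with $0 \le p < \tfrac12$ or $\tfrac12 < p \le 1$, and let $n$ be even. Inserting the pairs sequence $2,1,4,3,6,5,\ldots,n,n-1$ into an initially empty binary search tree, applying \textsc{RebalanceZig} after each insertion, results in a binary search tree whose expected average node depth is $\Theta(n)$.
   Context: Each new element is first placed as a new leaf $v$ at its standard unbalanced BST position, and then \textsc{RebalanceZig}$(v)$ is applied: while $v$ has a parent and an independent coin flip shows tail (tail has probability $p$, head probability $1-p$), set $v\gets$ parent of $v$; afterwards, if $v$ has a parent, rotate $v$ up (the standard single rotation at the parent of $v$ that moves $v$ one level up). The depth of a node is the number of edges from it to the root; the average node depth is the sum of depths of all $n$ nodes divided by $n$. Expectation is over the coin flips.
   Formalization: The constant p takes only rational values in the ranges $0 \le p < \tfrac12$ or $\tfrac12 < p \le 1$. -}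

module Defs where

open import Data.Nat as ℕ using (ℕ; zero; suc; _<ᵇ_)
open import Data.Bool using (Bool; true; false; if_then_else_)
open import Data.List using (List; []; _∷_; map; concatMap; upTo; reverse; foldr)
open import Data.Product using (_×_; _,_)
open import Data.Integer using (+_)
open import Data.Rational using (ℚ; _+_; _*_; _-_; _/_; 0ℚ; 1ℚ)

data Tree : Set where
  leaf : Tree
  node : Tree → ℕ → Tree → Tree

size : Tree → ℕ
size leaf = 0
size (node l _ r) = suc (size l ℕ.+ size r)

-- Sum of the depths (edges to the root) of all nodes.
depthSum : Tree → ℕ
depthSum leaf = 0
depthSum (node l _ r) = depthSum l ℕ.+ size l ℕ.+ depthSum r ℕ.+ size r

insert : ℕ → Tree → Tree
insert x leaf = node leaf x leaf
insert x (node l k r) =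
  if x <ᵇ k then node (insert x l) k r
  else if k <ᵇ x then node l k (insert x r)
  else node l k r

searchPath : ℕ → Tree → List ℕ
searchPath x leaf = []
searchPath x (node l k r) =
  if x <ᵇ k then k ∷ searchPath x l
  else if k <ᵇ x then k ∷ searchPath x r
  else k ∷ []

-- Rotate the node with key x one level up (single rotation at its parent);
-- does nothing if x is the root (or absent).
rotateUp : ℕ → Tree → Tree
rotateUp x leaf = leaf
rotateUp x (node l k r) =
  if x <ᵇ k then goL l
  else if k <ᵇ x then goR r
  else node l k r
  where
  goL : Tree → Tree
  goL leaf = node l k r
  goL (node ll lk lr) =
    if lk ℕ.≡ᵇ x then node ll lk (node lr k r)
    else node (rotateUp x l) k r
  goR : Tree → Tree
  goR leaf = node l k r
  goR (node rl rk rr) =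
    if rk ℕ.≡ᵇ x then node (node l k rl) rk rr
    else node l k (rotateUp x r)

Dist : Set → Set
Dist A = List (ℚ × A)

scale : ℚ → Dist Tree → Dist Tree
scale w = map (λ { (q , t) → (w * q , t) })

-- RebalanceZig on tree t, where the current node v and its ancestors are
-- given bottom-up (v first, root last).
rebalanceZig : ℚ → Tree → List ℕ → Dist Tree
rebalanceZig p t [] = (1ℚ , t) ∷ []
rebalanceZig p t (v ∷ []) = (1ℚ , t) ∷ []
rebalanceZig p t (v ∷ u ∷ rest) =
  (1ℚ - p , rotateUp v t) ∷ scale p (rebalanceZig p t (u ∷ rest))

insertZig : ℚ → ℕ → Tree → Dist Tree
insertZig p x t = let t' = insert x t in rebalanceZig p t' (reverse (searchPath x t'))

bindDist : Dist Tree → (Tree → Dist Tree) → Dist Tree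
bindDist d f = concatMap (λ { (q , t) → scale q (f t) }) d

insertAllZig : ℚ → List ℕ → Dist Tree
insertAllZig p = go ((1ℚ , leaf) ∷ [])
  where
  go : Dist Tree → List ℕ → Dist Tree
  go d [] = d
  go d (x ∷ xs) = go (bindDist d (insertZig p x)) xs

-- The pairs sequence 2,1,4,3,...,2m,2m-1 (n = 2m).
pairsSeq : ℕ → List ℕ
pairsSeq m = concatMap (λ i → (2 ℕ.+ 2 ℕ.* i) ∷ (1 ℕ.+ 2 ℕ.* i) ∷ []) (upTo m)

ℕtoℚ : ℕ → ℚ
ℕtoℚ n = + n / 1

expectation : Dist Tree → (Tree → ℚ) → ℚ
expectation d f = foldr (λ { (q , t) acc → q * f t + acc }) 0ℚ d

avgDepth : ℕ → Tree → ℚ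
avgDepth zero t = 0ℚ
avgDepth (suc k) t = ℕtoℚ (depthSum t) * (+ 1 / suc k)

expectedAvgDepthPairs : ℚ → ℕ → ℚ
expectedAvgDepthPairs p m = expectation (insertAllZig p (pairsSeq m)) (avgDepth (2 ℕ.* m))

module Submission where

-- Before the pair (2i + 2, 2i + 1) arrives every key is at most 2i, so both new keys are inserted below the
-- bottom of the right spine and RebalanceZig only rotates nodes on, or just below, that spine.  For each p
-- there is a potential Φ ≤ height whose expectation grows by a constant c > 0 per pair: the length of the
-- right spine for 0 < p < ½ and for p = 1; the length of the left spine minus (1 - p)/2 times that of the
-- right spine for ½ < p < 1; and for p = 0 the length of the left spine of the lowest right-spine node,
-- which grows by exactly 2.  Hence the expected height after m pairs is Ω(m), and since
-- depthSum ≥ (H² - H)/2 is convex in the height H, the expected average depth depthSum / 2m is Ω(m);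
-- depthSum ≤ size² gives O(m).

open import Defs

module Arithmetic where

  open import Data.Nat as ℕ using (ℕ; zero; suc)
  import Data.Nat.Properties as ℕ
  import Data.Integer as ℤ
  import Data.Integer.Properties as ℤ
  open import Data.Nat.Coprimality using (1-coprimeTo; sym)
  open import Data.Rational as ℚ using (ℚ; 0ℚ; 1ℚ; _+_; _*_; _-_; -_; _≤_; _<_; _/_; mkℚ; nonNegative; positive)
  open import Data.Rational.Properties
  open import Data.Rational.Solver using (module +-*-Solver)
  open import Algebra.Definitions.RawSemiring ℚ.+-*-rawSemiring public using (_^_)
  open import Data.Sum using (inj₁; inj₂)
  open import Relation.Binary.PropositionalEquality
    using (_≡_; refl; cong; cong₂; subst; subst₂; module ≡-Reasoning)
    renaming (sym to ≡-sym; trans to ≡-trans)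
  open +-*-Solver

  2ℚ : ℚ
  2ℚ = 1ℚ + 1ℚ

  ℕtoℚ≡mkℚ : ∀ n → ℕtoℚ n ≡ mkℚ (ℤ.+ n) 0 (sym (1-coprimeTo n))
  ℕtoℚ≡mkℚ n = normalize-coprime (sym (1-coprimeTo n))

  ℕtoℚ-suc : ∀ n → ℕtoℚ (suc n) ≡ 1ℚ + ℕtoℚ n
  ℕtoℚ-suc n = ≡-sym (begin
    1ℚ + ℕtoℚ n                         ≡⟨ cong (1ℚ +_) (ℕtoℚ≡mkℚ n) ⟩
    (ℤ.+ 1 ℤ.+ ℤ.+ n ℤ.* ℤ.+ 1) ℚ./ 1   ≡⟨ cong (λ z → (ℤ.+ 1 ℤ.+ z) ℚ./ 1) (ℤ.*-identityʳ (ℤ.+ n)) ⟩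
    ℕtoℚ (suc n)                        ∎)
    where open ≡-Reasoning

  ℕtoℚ-+ : ∀ m n → ℕtoℚ (m ℕ.+ n) ≡ ℕtoℚ m + ℕtoℚ n
  ℕtoℚ-+ zero    n = ≡-sym (+-identityˡ (ℕtoℚ n))
  ℕtoℚ-+ (suc m) n = begin
    ℕtoℚ (suc (m ℕ.+ n))        ≡⟨ ℕtoℚ-suc (m ℕ.+ n) ⟩
    1ℚ + ℕtoℚ (m ℕ.+ n)         ≡⟨ cong (1ℚ +_) (ℕtoℚ-+ m n) ⟩
    1ℚ + (ℕtoℚ m + ℕtoℚ n)      ≡⟨ +-assoc 1ℚ (ℕtoℚ m) (ℕtoℚ n) ⟨
    1ℚ + ℕtoℚ m + ℕtoℚ n        ≡⟨ cong (_+ ℕtoℚ n) (ℕtoℚ-suc m) ⟨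
    ℕtoℚ (suc m) + ℕtoℚ n       ∎
    where open ≡-Reasoning

  ℕtoℚ-* : ∀ m n → ℕtoℚ (m ℕ.* n) ≡ ℕtoℚ m * ℕtoℚ n
  ℕtoℚ-* zero    n = ≡-sym (*-zeroˡ (ℕtoℚ n))
  ℕtoℚ-* (suc m) n = begin
    ℕtoℚ (n ℕ.+ m ℕ.* n)        ≡⟨ ℕtoℚ-+ n (m ℕ.* n) ⟩
    ℕtoℚ n + ℕtoℚ (m ℕ.* n)     ≡⟨ cong (ℕtoℚ n +_) (ℕtoℚ-* m n) ⟩
    ℕtoℚ n + ℕtoℚ m * ℕtoℚ n    ≡⟨ solve 2 (λ a b → b :+ a :* b := (con 1ℚ :+ a) :* b) refl (ℕtoℚ m) _ ⟩
    (1ℚ + ℕtoℚ m) * ℕtoℚ n      ≡⟨ cong (_* ℕtoℚ n) (ℕtoℚ-suc m) ⟨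
    ℕtoℚ (suc m) * ℕtoℚ n       ∎
    where open ≡-Reasoning

  ℕtoℚ-nonNeg : ∀ n → 0ℚ ≤ ℕtoℚ n
  ℕtoℚ-nonNeg n = subst (0ℚ ≤_) (≡-sym (ℕtoℚ≡mkℚ n)) (nonNegative⁻¹ _)

  *-nonNeg : ∀ {p q} → 0ℚ ≤ p → 0ℚ ≤ q → 0ℚ ≤ p * q
  *-nonNeg {p} {q} 0≤p 0≤q = nonNegative⁻¹ (p * q) {{nonNeg*nonNeg⇒nonNeg p {{nonNegative 0≤p}} q {{nonNegative 0≤q}}}}

  +-nonNeg : ∀ {p q} → 0ℚ ≤ p → 0ℚ ≤ q → 0ℚ ≤ p + q
  +-nonNeg = +-mono-≤

  *-pos : ∀ {p q} → 0ℚ < p → 0ℚ < q → 0ℚ < p * q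
  *-pos {p} {q} 0<p 0<q = positive⁻¹ (p * q) {{pos*pos⇒pos p {{positive 0<p}} q {{positive 0<q}}}}

  *-monoˡ-≤-nonNeg′ : ∀ {r p q} → 0ℚ ≤ r → p ≤ q → r * p ≤ r * q
  *-monoˡ-≤-nonNeg′ {r} 0≤r = *-monoˡ-≤-nonNeg r {{nonNegative 0≤r}}

  *-monoʳ-≤-nonNeg′ : ∀ {r p q} → 0ℚ ≤ r → p ≤ q → p * r ≤ q * r
  *-monoʳ-≤-nonNeg′ {r} 0≤r = *-monoʳ-≤-nonNeg r {{nonNegative 0≤r}}

  square-nonNeg : ∀ p → 0ℚ ≤ p * p
  square-nonNeg p with ≤-total 0ℚ p
  ... | inj₁ 0≤p = *-nonNeg 0≤p 0≤p
  ... | inj₂ p≤0 = subst (0ℚ ≤_) (solve 1 (λ a → (:- a) :* (:- a) := a :* a) refl p)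
                     (*-nonNeg (neg-antimono-≤ p≤0) (neg-antimono-≤ p≤0))

  p≤q⇒0≤q-p : ∀ {p q} → p ≤ q → 0ℚ ≤ q - p
  p≤q⇒0≤q-p {p} {q} h = subst (_≤ q - p) (+-inverseʳ p) (+-monoˡ-≤ (- p) h)

  p<q⇒0<q-p : ∀ {p q} → p < q → 0ℚ < q - p
  p<q⇒0<q-p {p} {q} h = subst (_< q - p) (+-inverseʳ p) (+-monoˡ-< (- p) h)

  ≤-by-nonNeg-gap : ∀ {p q} r → q ≡ p + r → 0ℚ ≤ r → p ≤ q
  ≤-by-nonNeg-gap {p} r q≡p+r 0≤r =
    subst₂ _≤_ (+-identityʳ p) (≡-sym q≡p+r) (+-monoʳ-≤ p 0≤r)

  ℕtoℚ-mono-≤ : ∀ {m n} → m ℕ.≤ n → ℕtoℚ m ≤ ℕtoℚ n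
  ℕtoℚ-mono-≤ {m} {n} m≤n = ≤-by-nonNeg-gap (ℕtoℚ (n ℕ.∸ m))
    (≡-trans (cong ℕtoℚ (≡-sym (ℕ.m+[n∸m]≡n m≤n))) (ℕtoℚ-+ m (n ℕ.∸ m)))
    (ℕtoℚ-nonNeg (n ℕ.∸ m))

  ^-nonNeg : ∀ {p} → 0ℚ ≤ p → ∀ k → 0ℚ ≤ p ^ k
  ^-nonNeg 0≤p zero    = nonNegative⁻¹ 1ℚ
  ^-nonNeg 0≤p (suc k) = *-nonNeg 0≤p (^-nonNeg 0≤p k)

  ^-≤1 : ∀ {p} → 0ℚ ≤ p → p ≤ 1ℚ → ∀ k → p ^ k ≤ 1ℚ
  ^-≤1 0≤p p≤1 zero    = ≤-refl
  ^-≤1 0≤p p≤1 (suc k) =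
    ≤-trans (*-monoˡ-≤-nonNeg′ 0≤p (^-≤1 0≤p p≤1 k)) (subst (_≤ 1ℚ) (≡-sym (*-identityʳ _)) p≤1)

  1/[1+k] : ℕ → ℚ
  1/[1+k] k = ℤ.+ 1 / suc k

  1/[1+k]*[1+k]≡1 : ∀ k → 1/[1+k] k * ℕtoℚ (suc k) ≡ 1ℚ
  1/[1+k]*[1+k]≡1 k = ≡-trans (cong₂ _*_ (normalize-coprime (1-coprimeTo (suc k))) (ℕtoℚ≡mkℚ (suc k)))
    (*-inverseˡ (mkℚ (ℤ.+ suc k) 0 (sym (1-coprimeTo (suc k)))))

  1/[1+k]-nonNeg : ∀ k → 0ℚ ≤ 1/[1+k] k
  1/[1+k]-nonNeg k = nonNegative⁻¹ _ {{normalize-nonNeg 1 (suc k)}}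

  a*T≤b⇒a≤b*w : ∀ {a b w T} → 0ℚ ≤ w → w * T ≡ 1ℚ → a * T ≤ b → a ≤ b * w
  a*T≤b⇒a≤b*w {a} {b} {w} {T} 0≤w wT≡1 aT≤b = begin
    a               ≡⟨ ≡-trans (≡-sym (*-identityʳ a)) (cong (a *_) (≡-sym wT≡1)) ⟩
    a * (w * T)     ≡⟨ solve 3 (λ a w T → a :* (w :* T) := (a :* T) :* w) refl a w T ⟩
    (a * T) * w     ≤⟨ *-monoʳ-≤-nonNeg′ 0≤w aT≤b ⟩
    b * w           ∎
    where open ≤-Reasoning

  b≤a*T⇒b*w≤a : ∀ {a b w T} → 0ℚ ≤ w → w * T ≡ 1ℚ → b ≤ a * T → b * w ≤ a
  b≤a*T⇒b*w≤a {a} {b} {w} {T} 0≤w wT≡1 b≤aT = begin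
    b * w           ≤⟨ *-monoʳ-≤-nonNeg′ 0≤w b≤aT ⟩
    (a * T) * w     ≡⟨ solve 3 (λ a w T → (a :* T) :* w := a :* (w :* T)) refl a w T ⟩
    a * (w * T)     ≡⟨ ≡-trans (cong (a *_) wT≡1) (*-identityʳ a) ⟩
    a               ∎
    where open ≤-Reasoning

open Arithmetic


module Distributions where

  open import Data.Rational using (ℚ; 0ℚ; 1ℚ; _+_; _*_; _-_; -_; _≤_)
  open import Data.Rational.Properties
  open import Data.Rational.Solver using (module +-*-Solver)
  open import Data.List using (_++_; []; _∷_)
  open import Data.List.Relation.Unary.All using (All; []; _∷_)
  open import Data.Product using (_×_; _,_; proj₁; proj₂)
  open import Relation.Binary.PropositionalEquality
    using (_≡_; refl; cong; cong₂; subst; module ≡-Reasoning)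
    renaming (sym to ≡-sym; trans to ≡-trans)
  open +-*-Solver

  𝔼 : Dist Tree → (Tree → ℚ) → ℚ
  𝔼 = expectation

  mass : Dist Tree → ℚ
  mass d = 𝔼 d (λ _ → 1ℚ)

  𝔼-++ : ∀ d₁ d₂ f → 𝔼 (d₁ ++ d₂) f ≡ 𝔼 d₁ f + 𝔼 d₂ f
  𝔼-++ []             d₂ f = ≡-sym (+-identityˡ _)
  𝔼-++ ((q , t) ∷ d₁) d₂ f =
    ≡-trans (cong (q * f t +_) (𝔼-++ d₁ d₂ f)) (≡-sym (+-assoc (q * f t) _ _))

  𝔼-scale : ∀ w d f → 𝔼 (scale w d) f ≡ w * 𝔼 d f
  𝔼-scale w []            f = ≡-sym (*-zeroʳ w)
  𝔼-scale w ((q , t) ∷ d) f = ≡-trans (cong (w * q * f t +_) (𝔼-scale w d f))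
    (solve 4 (λ w q x e → w :* q :* x :+ w :* e := w :* (q :* x :+ e)) refl w q (f t) (𝔼 d f))

  𝔼-bind : ∀ d g f → 𝔼 (bindDist d g) f ≡ 𝔼 d (λ t → 𝔼 (g t) f)
  𝔼-bind []            g f = refl
  𝔼-bind ((q , t) ∷ d) g f = ≡-trans (𝔼-++ (scale q (g t)) _ f)
    (cong₂ _+_ (𝔼-scale q (g t) f) (𝔼-bind d g f))

  𝔼-+ : ∀ d f g → 𝔼 d (λ t → f t + g t) ≡ 𝔼 d f + 𝔼 d g
  𝔼-+ []            f g = ≡-sym (+-identityˡ 0ℚ)
  𝔼-+ ((q , t) ∷ d) f g = ≡-trans (cong (q * (f t + g t) +_) (𝔼-+ d f g))
    (solve 5 (λ q a b x y → q :* (a :+ b) :+ (x :+ y) := q :* a :+ x :+ (q :* b :+ y))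
       refl q (f t) (g t) (𝔼 d f) (𝔼 d g))

  𝔼-*ˡ : ∀ d c f → 𝔼 d (λ t → c * f t) ≡ c * 𝔼 d f
  𝔼-*ˡ []            c f = ≡-sym (*-zeroʳ c)
  𝔼-*ˡ ((q , t) ∷ d) c f = ≡-trans (cong (q * (c * f t) +_) (𝔼-*ˡ d c f))
    (solve 4 (λ q c a x → q :* (c :* a) :+ c :* x := c :* (q :* a :+ x)) refl q c (f t) (𝔼 d f))

  𝔼-cong : ∀ d {f g} → (∀ t → f t ≡ g t) → 𝔼 d f ≡ 𝔼 d g
  𝔼-cong []            f≡g = refl
  𝔼-cong ((q , t) ∷ d) f≡g = cong₂ (λ a b → q * a + b) (f≡g t) (𝔼-cong d f≡g)

  𝔼-linear : ∀ d f c g → 𝔼 d (λ t → f t - c * g t) ≡ 𝔼 d f - c * 𝔼 d g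
  𝔼-linear d f c g = begin
    𝔼 d (λ t → f t - c * g t)           ≡⟨ 𝔼-+ d f (λ t → - (c * g t)) ⟩
    𝔼 d f + 𝔼 d (λ t → - (c * g t))     ≡⟨ cong (𝔼 d f +_) (𝔼-cong d (λ t → neg-distribˡ-* c (g t))) ⟩
    𝔼 d f + 𝔼 d (λ t → - c * g t)       ≡⟨ cong (𝔼 d f +_) (𝔼-*ˡ d (- c) g) ⟩
    𝔼 d f + - c * 𝔼 d g                 ≡⟨ cong (𝔼 d f +_) (neg-distribˡ-* c (𝔼 d g)) ⟨
    𝔼 d f - c * 𝔼 d g                   ∎
    where open ≡-Reasoning

  NonNegOn : (Tree → Set) → Dist Tree → Set
  NonNegOn P = All (λ (q , t) → 0ℚ ≤ q × P t)

  ProbOn : (Tree → Set) → Dist Tree → Set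
  ProbOn P d = NonNegOn P d × mass d ≡ 1ℚ

  𝔼-mono : ∀ {P d f g} → NonNegOn P d → (∀ t → P t → f t ≤ g t) → 𝔼 d f ≤ 𝔼 d g
  𝔼-mono []                 f≤g = ≤-refl
  𝔼-mono ((0≤q , Pt) ∷ nn) f≤g = +-mono-≤ (*-monoˡ-≤-nonNeg′ 0≤q (f≤g _ Pt)) (𝔼-mono nn f≤g)

  𝔼-congOn : ∀ {P d f g} → NonNegOn P d → (∀ t → P t → f t ≡ g t) → 𝔼 d f ≡ 𝔼 d g
  𝔼-congOn nn f≡g = ≤-antisym (𝔼-mono nn (λ t Pt → ≤-reflexive (f≡g t Pt)))
                              (𝔼-mono nn (λ t Pt → ≤-reflexive (≡-sym (f≡g t Pt))))

  𝔼-const : ∀ {P d} → ProbOn P d → ∀ c → 𝔼 d (λ _ → c) ≡ c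
  𝔼-const {d = d} (_ , mass≡1) c = begin
    𝔼 d (λ _ → c)        ≡⟨ 𝔼-cong d (λ _ → ≡-sym (*-identityʳ c)) ⟩
    𝔼 d (λ _ → c * 1ℚ)   ≡⟨ 𝔼-*ˡ d c (λ _ → 1ℚ) ⟩
    c * mass d           ≡⟨ cong (c *_) mass≡1 ⟩
    c * 1ℚ               ≡⟨ *-identityʳ c ⟩
    c                    ∎
    where open ≡-Reasoning

  𝔼-lowerBound : ∀ {P d f} a → ProbOn P d → (∀ t → P t → a ≤ f t) → a ≤ 𝔼 d f
  𝔼-lowerBound {d = d} a prob a≤f =
    subst (_≤ 𝔼 d _) (𝔼-const prob a) (𝔼-mono (proj₁ prob) a≤f)

  NonNegOn-++ : ∀ {P} d₁ {d₂} → NonNegOn P d₁ → NonNegOn P d₂ → NonNegOn P (d₁ ++ d₂)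
  NonNegOn-++ []      []       nn₂ = nn₂
  NonNegOn-++ (_ ∷ d) (h ∷ nn) nn₂ = h ∷ NonNegOn-++ d nn nn₂

  NonNegOn-scale : ∀ {P w d} → 0ℚ ≤ w → NonNegOn P d → NonNegOn P (scale w d)
  NonNegOn-scale 0≤w []                 = []
  NonNegOn-scale 0≤w ((0≤q , Pt) ∷ nn) = (*-nonNeg 0≤w 0≤q , Pt) ∷ NonNegOn-scale 0≤w nn

  NonNegOn-bind : ∀ {P R d g} → NonNegOn P d → (∀ t → P t → NonNegOn R (g t)) → NonNegOn R (bindDist d g)
  NonNegOn-bind []                 h = []
  NonNegOn-bind {d = (q , t) ∷ _} {g} ((0≤q , Pt) ∷ nn) h =
    NonNegOn-++ (scale q (g t)) (NonNegOn-scale 0≤q (h _ Pt)) (NonNegOn-bind nn h)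

  ProbOn-bind : ∀ {P R d g} → ProbOn P d → (∀ t → P t → ProbOn R (g t)) → ProbOn R (bindDist d g)
  ProbOn-bind {d = d} {g} prob h =
    NonNegOn-bind (proj₁ prob) (λ t Pt → proj₁ (h t Pt)) , (begin
      mass (bindDist d g)        ≡⟨ 𝔼-bind d g (λ _ → 1ℚ) ⟩
      𝔼 d (λ t → mass (g t))     ≡⟨ 𝔼-congOn (proj₁ prob) (λ t Pt → proj₂ (h t Pt)) ⟩
      mass d                     ≡⟨ proj₂ prob ⟩
      1ℚ                         ∎)
    where open ≡-Reasoning

open Distributions


module SearchTrees where

  open import Data.Nat using (ℕ; suc; _+_; _<_; _≤_; _<ᵇ_; _≡ᵇ_)
  open import Data.Nat.Properties
  open import Data.Bool using (true; false; T)
  open import Data.Bool.Properties using (T-≡)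
  open import Data.Unit using (⊤; tt)
  open import Data.Empty using (⊥-elim)
  open import Data.Product using (_×_; _,_)
  open import Data.List using ([]; _∷_)
  open import Data.List.Relation.Unary.All using (All; []; _∷_)
  open import Function using (Equivalence)
  open import Relation.Binary.PropositionalEquality

  AllKeys : (ℕ → Set) → Tree → Set
  AllKeys P leaf         = ⊤
  AllKeys P (node l k r) = AllKeys P l × P k × AllKeys P r

  AllKeys-map : ∀ {P Q : ℕ → Set} → (∀ {k} → P k → Q k) → ∀ t → AllKeys P t → AllKeys Q t
  AllKeys-map f leaf         _              = tt
  AllKeys-map f (node l k r) (Pl , Pk , Pr) = AllKeys-map f l Pl , f Pk , AllKeys-map f r Pr

  IsBST : Tree → Set
  IsBST leaf         = ⊤
  IsBST (node l k r) = AllKeys (_< k) l × AllKeys (k <_) r × IsBST l × IsBST r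

  NotRoot : ℕ → Tree → Set
  NotRoot x leaf         = ⊤
  NotRoot x (node _ k _) = k ≢ x

  ≡true⇒T : ∀ {b} → b ≡ true → T b
  ≡true⇒T = Equivalence.from T-≡

  <ᵇ-true : ∀ {m n} → m < n → (m <ᵇ n) ≡ true
  <ᵇ-true m<n = Equivalence.to T-≡ (<⇒<ᵇ m<n)

  <ᵇ-false : ∀ {m n} → n ≤ m → (m <ᵇ n) ≡ false
  <ᵇ-false {m} {n} n≤m with m <ᵇ n in eq
  ... | false = refl
  ... | true  = ⊥-elim (<⇒≱ (<ᵇ⇒< m n (≡true⇒T eq)) n≤m)

  ≡ᵇ-true : ∀ m → (m ≡ᵇ m) ≡ true
  ≡ᵇ-true m = Equivalence.to T-≡ (≡⇒≡ᵇ m m refl)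

  ≡ᵇ-false : ∀ {m n} → m ≢ n → (m ≡ᵇ n) ≡ false
  ≡ᵇ-false {m} {n} m≢n with m ≡ᵇ n in eq
  ... | false = refl
  ... | true  = ⊥-elim (m≢n (≡ᵇ⇒≡ m n (≡true⇒T eq)))

  insert-< : ∀ {x k} l r → x < k → insert x (node l k r) ≡ node (insert x l) k r
  insert-< l r x<k rewrite <ᵇ-true x<k = refl

  insert-> : ∀ {x k} l r → k < x → insert x (node l k r) ≡ node l k (insert x r)
  insert-> l r k<x rewrite <ᵇ-false (<⇒≤ k<x) | <ᵇ-true k<x = refl

  searchPath-< : ∀ {x k} l r → x < k → searchPath x (node l k r) ≡ k ∷ searchPath x l
  searchPath-< l r x<k rewrite <ᵇ-true x<k = refl

  searchPath-> : ∀ {x k} l r → k < x → searchPath x (node l k r) ≡ k ∷ searchPath x r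
  searchPath-> l r k<x rewrite <ᵇ-false (<⇒≤ k<x) | <ᵇ-true k<x = refl

  searchPath-root : ∀ {x} l r → searchPath x (node l x r) ≡ x ∷ []
  searchPath-root {x} l r rewrite <ᵇ-false (≤-refl {x}) = refl

  rotateUp-leftChild : ∀ {x k} ll lr r → x < k →
    rotateUp x (node (node ll x lr) k r) ≡ node ll x (node lr k r)
  rotateUp-leftChild {x} ll lr r x<k rewrite <ᵇ-true x<k | ≡ᵇ-true x = refl

  rotateUp-rightChild : ∀ {x k} l rl rr → k < x →
    rotateUp x (node l k (node rl x rr)) ≡ node (node l k rl) x rr
  rotateUp-rightChild {x} l rl rr k<x rewrite <ᵇ-false (<⇒≤ k<x) | <ᵇ-true k<x | ≡ᵇ-true x = refl

  rotateUp-inLeft : ∀ {x k} l r → x < k → NotRoot x l → rotateUp x (node l k r) ≡ node (rotateUp x l) k r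
  rotateUp-inLeft leaf            r x<k _   rewrite <ᵇ-true x<k = refl
  rotateUp-inLeft (node ll lk lr) r x<k lk≢x rewrite <ᵇ-true x<k | ≡ᵇ-false lk≢x = refl

  rotateUp-inRight : ∀ {x k} l r → k < x → NotRoot x r → rotateUp x (node l k r) ≡ node l k (rotateUp x r)
  rotateUp-inRight l leaf k<x _ rewrite <ᵇ-false (<⇒≤ k<x) | <ᵇ-true k<x = refl
  rotateUp-inRight l (node rl rk rr) k<x rk≢x
    rewrite <ᵇ-false (<⇒≤ k<x) | <ᵇ-true k<x | ≡ᵇ-false rk≢x = refl

  data RotateUp (x : ℕ) : Tree → Tree → Set where
    unchanged  : ∀ {t} → RotateUp x t t
    leftChild  : ∀ {ll lr k r} → x < k → RotateUp x (node (node ll x lr) k r) (node ll x (node lr k r))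
    inLeft     : ∀ {l k r} → x < k → RotateUp x (node l k r) (node (rotateUp x l) k r)
    rightChild : ∀ {l k rl rr} → k < x → RotateUp x (node l k (node rl x rr)) (node (node l k rl) x rr)
    inRight    : ∀ {l k r} → k < x → RotateUp x (node l k r) (node l k (rotateUp x r))

  rotateUp-view : ∀ x t → RotateUp x t (rotateUp x t)
  rotateUp-view x leaf = unchanged
  rotateUp-view x (node l k r) with x <ᵇ k in x<ᵇk
  rotateUp-view x (node leaf k r) | true = unchanged
  rotateUp-view x (node (node ll lk lr) k r) | true with lk ≡ᵇ x in lk≡ᵇx
  ... | true rewrite ≡ᵇ⇒≡ lk x (≡true⇒T lk≡ᵇx) = leftChild (<ᵇ⇒< x k (≡true⇒T x<ᵇk))
  ... | false = inLeft (<ᵇ⇒< x k (≡true⇒T x<ᵇk))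
  rotateUp-view x (node l k r) | false with k <ᵇ x in k<ᵇx
  rotateUp-view x (node l k leaf) | false | true = unchanged
  rotateUp-view x (node l k (node rl rk rr)) | false | true with rk ≡ᵇ x in rk≡ᵇx
  ... | true rewrite ≡ᵇ⇒≡ rk x (≡true⇒T rk≡ᵇx) = rightChild (<ᵇ⇒< k x (≡true⇒T k<ᵇx))
  ... | false = inRight (<ᵇ⇒< k x (≡true⇒T k<ᵇx))
  rotateUp-view x (node l k r) | false | false = unchanged

  AllKeys-rotateUp : ∀ {P} x t → AllKeys P t → AllKeys P (rotateUp x t)
  AllKeys-rotateUp x t Pt with rotateUp x t | rotateUp-view x t
  ... | _ | unchanged = Pt
  ... | _ | leftChild _ = let ((Pll , Px , Plr) , Pk , Pr) = Pt in Pll , Px , (Plr , Pk , Pr)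
  ... | _ | rightChild _ = let (Pl , Pk , (Prl , Px , Prr)) = Pt in (Pl , Pk , Prl) , Px , Prr
  AllKeys-rotateUp x (node l k r) (Pl , Pk , Pr) | _ | inLeft _  = AllKeys-rotateUp x l Pl , Pk , Pr
  AllKeys-rotateUp x (node l k r) (Pl , Pk , Pr) | _ | inRight _ = Pl , Pk , AllKeys-rotateUp x r Pr

  +-suc-assoc : ∀ a b c → a + suc (b + c) ≡ suc (a + b + c)
  +-suc-assoc a b c = trans (+-suc a (b + c)) (cong suc (sym (+-assoc a b c)))

  size-rotateUp : ∀ x t → size (rotateUp x t) ≡ size t
  size-rotateUp x t with rotateUp x t | rotateUp-view x t
  ... | _ | unchanged = refl
  ... | _ | leftChild {ll} {lr} {_} {r} _  = cong suc (+-suc-assoc (size ll) (size lr) (size r))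
  ... | _ | rightChild {l} {_} {rl} {rr} _ = cong suc (sym (+-suc-assoc (size l) (size rl) (size rr)))
  size-rotateUp x (node l k r) | _ | inLeft _  = cong (λ n → suc (n + size r)) (size-rotateUp x l)
  size-rotateUp x (node l k r) | _ | inRight _ = cong (λ n → suc (size l + n)) (size-rotateUp x r)

  IsBST-rotateUp : ∀ x t → IsBST t → IsBST (rotateUp x t)
  IsBST-rotateUp x t bst with rotateUp x t | rotateUp-view x t
  ... | _ | unchanged = bst
  ... | _ | leftChild {r = r} _ =
    let ((ll<x , x<k , lr<k) , k<r , (ll<x' , x<lr , bll , blr) , br) = bst
    in ll<x' , (x<lr , x<k , AllKeys-map (<-trans x<k) r k<r) , bll , (lr<k , k<r , blr , br)
  ... | _ | rightChild {l} _ =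
    let (l<k , (k<rl , k<x , k<rr) , bl , (rl<x , x<rr , brl , brr)) = bst
    in (AllKeys-map (λ h → <-trans h k<x) l l<k , k<x , rl<x) , x<rr , (l<k , k<rl , bl , brl) , brr
  IsBST-rotateUp x (node l k r) (l<k , k<r , bl , br) | _ | inLeft _ =
    AllKeys-rotateUp x l l<k , k<r , IsBST-rotateUp x l bl , br
  IsBST-rotateUp x (node l k r) (l<k , k<r , bl , br) | _ | inRight _ =
    l<k , AllKeys-rotateUp x r k<r , bl , IsBST-rotateUp x r br

  AllKeys-insert : ∀ {P : ℕ → Set} {x} t → P x → AllKeys P t → AllKeys P (insert x t)
  AllKeys-insert leaf Px _ = tt , Px , tt
  AllKeys-insert {x = x} (node l k r) Px (Pl , Pk , Pr) with x <ᵇ k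
  ... | true = AllKeys-insert l Px Pl , Pk , Pr
  ... | false with k <ᵇ x
  ... | true  = Pl , Pk , AllKeys-insert r Px Pr
  ... | false = Pl , Pk , Pr

  IsBST-insert : ∀ x t → IsBST t → IsBST (insert x t)
  IsBST-insert x leaf _ = tt , tt , tt , tt
  IsBST-insert x (node l k r) (l<k , k<r , bl , br) with x <ᵇ k in x<ᵇk
  ... | true = AllKeys-insert l (<ᵇ⇒< x k (≡true⇒T x<ᵇk)) l<k , k<r , IsBST-insert x l bl , br
  ... | false with k <ᵇ x in k<ᵇx
  ... | true  = l<k , AllKeys-insert r (<ᵇ⇒< k x (≡true⇒T k<ᵇx)) k<r , bl , IsBST-insert x r br
  ... | false = l<k , k<r , bl , br

  size-insert : ∀ x t → AllKeys (_≢ x) t → size (insert x t) ≡ suc (size t)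
  size-insert x leaf _ = refl
  size-insert x (node l k r) (l≢x , k≢x , r≢x) with x <ᵇ k in x<ᵇk
  ... | true = cong (λ n → suc (n + size r)) (size-insert x l l≢x)
  ... | false with k <ᵇ x in k<ᵇx
  ... | true  = trans (cong (λ n → suc (size l + n)) (size-insert x r r≢x)) (cong suc (+-suc (size l) (size r)))
  ... | false = ⊥-elim (k≢x (≤-antisym (≮⇒≥ (λ x<k → subst T x<ᵇk (<⇒<ᵇ x<k)))
                                      (≮⇒≥ (λ k<x → subst T k<ᵇx (<⇒<ᵇ k<x)))))

  searchPath-AllKeys : ∀ {P : ℕ → Set} x t → AllKeys P t → All P (searchPath x t)
  searchPath-AllKeys x leaf _ = []
  searchPath-AllKeys x (node l k r) (Pl , Pk , Pr) with x <ᵇ k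
  ... | true = Pk ∷ searchPath-AllKeys x l Pl
  ... | false with k <ᵇ x
  ... | true  = Pk ∷ searchPath-AllKeys x r Pr
  ... | false = Pk ∷ []

open SearchTrees


module Spines where

  open import Data.Nat using (ℕ; suc; _<_)
  open import Data.Nat.Properties using (<⇒≢)
  open import Data.Product using (_×_; _,_; proj₂; ∃-syntax)
  open import Data.List using (List; []; _∷_; _++_; map; length; reverse; [_])
  open import Data.List.Properties using (length-reverse; length-map)
  open import Data.List.Relation.Unary.All as All using (All; []; _∷_)
  open import Data.List.Relation.Unary.AllPairs using (AllPairs; []; _∷_)
  import Data.List.Relation.Unary.AllPairs.Properties as AllPairs
  open import Data.List.Relation.Binary.Permutation.Propositional using (↭-sym)
  open import Data.List.Relation.Binary.Permutation.Propositional.Properties using (All-resp-↭; ↭-reverse)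
  open import Relation.Binary.PropositionalEquality hiding ([_])

  All-reverse⁺ : ∀ {A : Set} {P : A → Set} {xs} → All P xs → All P (reverse xs)
  All-reverse⁺ {xs = xs} = All-resp-↭ (↭-sym (↭-reverse xs))

  AllPairs-∷ʳ : ∀ {xs y} → AllPairs _<_ xs → All (_< y) xs → AllPairs _<_ (xs ++ [ y ])
  AllPairs-∷ʳ asc below = AllPairs.++⁺ asc ([] ∷ []) (All.map (_∷ []) below)

  -- The nodes of a right spine, top-down, as (left subtree, key); graft S t hangs t below the last one.
  Spine : Set
  Spine = List (Tree × ℕ)

  graft : Spine → Tree → Tree
  graft []            t = t
  graft ((l , k) ∷ S) t = node l k (graft S t)

  spineKeys : Spine → List ℕ
  spineKeys = map proj₂

  length-reverse-spineKeys : ∀ S → length (reverse (spineKeys S)) ≡ length S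
  length-reverse-spineKeys S = trans (length-reverse (spineKeys S)) (length-map proj₂ S)

  rightSpine : Tree → Spine
  rightSpine leaf         = []
  rightSpine (node l k r) = (l , k) ∷ rightSpine r

  graft-rightSpine : ∀ t → graft (rightSpine t) leaf ≡ t
  graft-rightSpine leaf         = refl
  graft-rightSpine (node l k r) = cong (node l k) (graft-rightSpine r)

  graft-++ : ∀ S S′ t → graft (S ++ S′) t ≡ graft S (graft S′ t)
  graft-++ []            S′ t = refl
  graft-++ ((l , k) ∷ S) S′ t = cong (node l k) (graft-++ S S′ t)

  insert-graft : ∀ {x} S t → All (_< x) (spineKeys S) → insert x (graft S t) ≡ graft S (insert x t)
  insert-graft []            t []          = refl
  insert-graft ((l , k) ∷ S) t (k<x ∷ S<x) =
    trans (insert-> l (graft S t) k<x) (cong (node l k) (insert-graft S t S<x))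

  searchPath-graft : ∀ {x} S t → All (_< x) (spineKeys S) →
    searchPath x (graft S t) ≡ spineKeys S ++ searchPath x t
  searchPath-graft []            t []          = refl
  searchPath-graft ((l , k) ∷ S) t (k<x ∷ S<x) =
    trans (searchPath-> l (graft S t) k<x) (cong (k ∷_) (searchPath-graft S t S<x))

  NotRoot-graft : ∀ {x} S t → All (_< x) (spineKeys S) → NotRoot x t → NotRoot x (graft S t)
  NotRoot-graft []            t []        x∉t = x∉t
  NotRoot-graft ((l , k) ∷ S) t (k<x ∷ _) _   = <⇒≢ k<x

  rotateUp-graft : ∀ {x} S t → All (_< x) (spineKeys S) → NotRoot x t →
    rotateUp x (graft S t) ≡ graft S (rotateUp x t)
  rotateUp-graft []            t []          _   = refl
  rotateUp-graft ((l , k) ∷ S) t (k<x ∷ S<x) x∉t =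
    trans (rotateUp-inRight l (graft S t) k<x (NotRoot-graft S t S<x x∉t))
          (cong (node l k) (rotateUp-graft S t S<x x∉t))

  AllKeys-graft : ∀ {P} S t → AllKeys P (graft S t) → All P (spineKeys S)
  AllKeys-graft []            t _              = []
  AllKeys-graft ((l , k) ∷ S) t (_ , Pk , Prest) = Pk ∷ AllKeys-graft S t Prest

  AllKeys-graft-tail : ∀ {P} S t → AllKeys P (graft S t) → AllKeys P t
  AllKeys-graft-tail []            t Pt             = Pt
  AllKeys-graft-tail ((l , k) ∷ S) t (_ , _ , Prest) = AllKeys-graft-tail S t Prest

  IsBST-graft : ∀ S t → IsBST (graft S t) → AllPairs _<_ (spineKeys S)
  IsBST-graft []            t _                   = []
  IsBST-graft ((l , k) ∷ S) t (_ , k<rest , _ , bst) = AllKeys-graft S t k<rest ∷ IsBST-graft S t bst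

  rotateUp-spineKey : ∀ A s Z → AllPairs _<_ (s ∷ spineKeys Z) →
    All (λ v → ∃[ Z′ ] length Z′ ≡ length Z × (∀ t → rotateUp v (graft ((A , s) ∷ Z) t) ≡ graft Z′ t))
        (spineKeys Z)
  rotateUp-spineKey A s []            _                         = []
  rotateUp-spineKey A s ((B , v) ∷ Z) ((s<v ∷ s<Z) ∷ v<Z ∷ asc) =
    ((node A s B , v) ∷ Z , refl , λ t → rotateUp-rightChild A B (graft Z t) s<v)
    ∷ All.zipWith below-s (s<Z , All.zip (v<Z , rotateUp-spineKey B v Z (v<Z ∷ asc)))
    where
    below-s : ∀ {w} → s < w × v < w ×
      ∃[ Z′ ] length Z′ ≡ length Z × (∀ t → rotateUp w (graft ((B , v) ∷ Z) t) ≡ graft Z′ t) →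
      ∃[ Z′ ] length Z′ ≡ suc (length Z) × (∀ t → rotateUp w (graft ((A , s) ∷ (B , v) ∷ Z) t) ≡ graft Z′ t)
    below-s (s<w , v<w , Z′ , |Z′| , rot) =
      (A , s) ∷ Z′ , cong suc |Z′| ,
      λ t → trans (rotateUp-inRight A _ s<w (<⇒≢ v<w)) (cong (node A s) (rot t))

  IsBST-graft-keys<tail : ∀ S t → IsBST (graft S t) → All (λ k → AllKeys (k <_) t) (spineKeys S)
  IsBST-graft-keys<tail []            t _                    = []
  IsBST-graft-keys<tail ((l , k) ∷ S) t (_ , k<rest , _ , bst) =
    AllKeys-graft-tail S t k<rest ∷ IsBST-graft-keys<tail S t bst

  snoc-view : ∀ (e : Tree × ℕ) Z → ∃[ S ] ∃[ e′ ] e ∷ Z ≡ S ++ [ e′ ]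
  snoc-view e []       = [] , e , refl
  snoc-view e (e₁ ∷ Z) with snoc-view e₁ Z
  ... | S , e′ , eq = e ∷ S , e′ , cong (e ∷_) eq

open Spines


module TreeStatistics where

  open import Data.Nat using (ℕ; suc; _+_; _*_; _≤_; _⊔_; z≤n; s≤s)
  open import Data.Nat.Properties
  open import Data.Nat.Solver using (module +-*-Solver)
  open import Data.Empty using (⊥-elim)
  open import Data.Product using (_,_)
  open import Data.Sum using (inj₁; inj₂)
  open import Data.List using ([]; _∷_; length)
  open import Relation.Binary.PropositionalEquality
  open +-*-Solver

  rightSpineLength : Tree → ℕ
  rightSpineLength leaf         = 0
  rightSpineLength (node l k r) = suc (rightSpineLength r)

  leftSpineLength : Tree → ℕ
  leftSpineLength leaf         = 0
  leftSpineLength (node l k r) = suc (leftSpineLength l)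

  bottomLeftSpineLength : Tree → ℕ
  bottomLeftSpineLength leaf                          = 0
  bottomLeftSpineLength (node l k leaf)               = suc (leftSpineLength l)
  bottomLeftSpineLength (node l k r@(node _ _ _))     = bottomLeftSpineLength r

  height : Tree → ℕ
  height leaf         = 0
  height (node l k r) = suc (height l ⊔ height r)

  rightSpineLength-graft : ∀ S t → rightSpineLength (graft S t) ≡ length S + rightSpineLength t
  rightSpineLength-graft []            t = refl
  rightSpineLength-graft ((l , k) ∷ S) t = cong suc (rightSpineLength-graft S t)

  bottomLeftSpineLength-graft : ∀ S A s → bottomLeftSpineLength (graft S (node A s leaf)) ≡ suc (leftSpineLength A)
  bottomLeftSpineLength-graft []                          A s = refl
  bottomLeftSpineLength-graft ((l , k) ∷ [])              A s = refl
  bottomLeftSpineLength-graft ((l , k) ∷ (l′ , k′) ∷ S)   A s = bottomLeftSpineLength-graft ((l′ , k′) ∷ S) A s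

  leftSpineLength-rotateUp : ∀ v A r R → r ≤ v → leftSpineLength (node A r R) ≤ leftSpineLength (rotateUp v (node A r R))
  leftSpineLength-rotateUp v A r R r≤v with rotateUp v (node A r R) | rotateUp-view v (node A r R)
  ... | _ | unchanged      = ≤-refl
  ... | _ | leftChild v<r  = ⊥-elim (<⇒≱ v<r r≤v)
  ... | _ | inLeft v<r     = ⊥-elim (<⇒≱ v<r r≤v)
  ... | _ | rightChild _   = n≤1+n _
  ... | _ | inRight _      = ≤-refl

  rightSpineLength≤height : ∀ t → rightSpineLength t ≤ height t
  rightSpineLength≤height leaf         = z≤n
  rightSpineLength≤height (node l k r) = s≤s (≤-trans (rightSpineLength≤height r) (m≤n⊔m (height l) (height r)))

  leftSpineLength≤height : ∀ t → leftSpineLength t ≤ height t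
  leftSpineLength≤height leaf         = z≤n
  leftSpineLength≤height (node l k r) = s≤s (≤-trans (leftSpineLength≤height l) (m≤m⊔n (height l) (height r)))

  bottomLeftSpineLength≤height : ∀ t → bottomLeftSpineLength t ≤ height t
  bottomLeftSpineLength≤height leaf                      = z≤n
  bottomLeftSpineLength≤height (node l k leaf)           = s≤s (≤-trans (leftSpineLength≤height l) (m≤m⊔n (height l) 0))
  bottomLeftSpineLength≤height (node l k r@(node _ _ _)) =
    ≤-trans (bottomLeftSpineLength≤height r) (≤-trans (n≤1+n _) (s≤s (m≤n⊔m (height l) (height r))))

  height≤size : ∀ t → height t ≤ size t
  height≤size leaf         = z≤n
  height≤size (node l k r) = s≤s (⊔-lub (≤-trans (height≤size l) (m≤m+n (size l) (size r)))
                                       (≤-trans (height≤size r) (m≤n+m (size r) (size l))))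

  depthSum≤size*size : ∀ t → depthSum t ≤ size t * size t
  depthSum≤size*size leaf         = z≤n
  depthSum≤size*size (node l k r) = begin
    depthSum l + size l + depthSum r + size r
      ≤⟨ +-monoˡ-≤ (size r) (+-mono-≤ (+-monoˡ-≤ (size l) (depthSum≤size*size l)) (depthSum≤size*size r)) ⟩
    a * a + a + b * b + b
      ≤⟨ m≤m+n (a * a + a + b * b + b) (1 + a + b + 2 * (a * b)) ⟩
    a * a + a + b * b + b + (1 + a + b + 2 * (a * b))
      ≡⟨ solve 2 (λ a b → a :* a :+ a :+ b :* b :+ b :+ (con 1 :+ a :+ b :+ con 2 :* (a :* b))
                         := (con 1 :+ (a :+ b)) :* (con 1 :+ (a :+ b))) refl a b ⟩
    suc (a + b) * suc (a + b)
      ∎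
    where
    open ≤-Reasoning
    a = size l
    b = size r

  private
    height-step : ∀ {h d s D} → h * h ≤ 2 * d + h → h ≤ s → d + s ≤ D → suc h * suc h ≤ 2 * D + suc h
    height-step {h} {d} {s} {D} ih h≤s d+s≤D = begin
      suc h * suc h         ≡⟨ solve 1 (λ h → (con 1 :+ h) :* (con 1 :+ h) := h :* h :+ (con 2 :* h :+ con 1)) refl h ⟩
      h * h + (2 * h + 1)   ≤⟨ +-monoˡ-≤ (2 * h + 1) ih ⟩
      2 * d + h + (2 * h + 1) ≡⟨ solve 2 (λ h d → con 2 :* d :+ h :+ (con 2 :* h :+ con 1)
                                                 := con 2 :* (d :+ h) :+ (con 1 :+ h)) refl h d ⟩
      2 * (d + h) + suc h   ≤⟨ +-monoˡ-≤ (suc h) (*-monoʳ-≤ 2 (≤-trans (+-monoʳ-≤ d h≤s) d+s≤D)) ⟩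
      2 * D + suc h         ∎
      where open ≤-Reasoning

  height*height≤2*depthSum+height : ∀ t → height t * height t ≤ 2 * depthSum t + height t
  height*height≤2*depthSum+height leaf = z≤n
  height*height≤2*depthSum+height (node l k r) with ≤-total (height l) (height r)
  ... | inj₁ hl≤hr rewrite m≤n⇒m⊔n≡n hl≤hr =
    height-step (height*height≤2*depthSum+height r) (height≤size r)
      (+-monoˡ-≤ (size r) (m≤n+m (depthSum r) (depthSum l + size l)))
  ... | inj₂ hr≤hl rewrite m≥n⇒m⊔n≡m hr≤hl =
    height-step (height*height≤2*depthSum+height l) (height≤size l)
      (≤-trans (m≤m+n (depthSum l + size l) (depthSum r)) (m≤m+n _ (size r)))

  1≤depthSum : ∀ t → 2 ≤ size t → 1 ≤ depthSum t
  1≤depthSum (node l@(node _ _ _) k r) _ =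
    ≤-trans (s≤s z≤n) (≤-trans (m≤n+m (size l) (depthSum l)) (≤-trans (m≤m+n _ (depthSum r)) (m≤m+n _ (size r))))
  1≤depthSum (node leaf k r@(node _ _ _)) _ = ≤-trans (s≤s z≤n) (m≤n+m (size r) (depthSum r))
  1≤depthSum (node leaf k leaf) (s≤s ())

open TreeStatistics


module Walks where

  open import Data.Nat as ℕ using (ℕ; suc; _<_)
  import Data.Nat.Properties as ℕ
  open import Data.Rational as ℚ using (ℚ; 0ℚ; 1ℚ; _+_; _*_; _-_; _≤_)
  open import Data.Rational.Properties
  open import Data.Rational.Solver using (module +-*-Solver)
  open import Data.List using ([]; _∷_; _++_; length; reverse; [_])
  open import Data.List.Properties using (unfold-reverse; reverse-++; map-++; length-++)
  open import Data.List.Relation.Unary.All as All using (All; []; _∷_)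
  open import Data.List.Relation.Unary.AllPairs using (AllPairs; _∷_)
  open import Data.Product using (_,_; proj₁; proj₂)
  open import Relation.Binary.PropositionalEquality
    using (_≡_; refl; cong; cong₂; subst; module ≡-Reasoning)
    renaming (sym to ≡-sym; trans to ≡-trans)
  open +-*-Solver

  Φright : Tree → ℚ
  Φright t = ℕtoℚ (rightSpineLength t)

  Φright-graft : ∀ S t → Φright (graft S t) ≡ ℕtoℚ (length S) + Φright t
  Φright-graft S t = ≡-trans (cong ℕtoℚ (rightSpineLength-graft S t)) (ℕtoℚ-+ (length S) (rightSpineLength t))

  Φright-graft-leaf : ∀ S → Φright (graft S leaf) ≡ ℕtoℚ (length S)
  Φright-graft-leaf S = ≡-trans (Φright-graft S leaf) (+-identityʳ (ℕtoℚ (length S)))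

  module Walk (p : ℚ) where

    𝔼-rebalanceZig-∷ : ∀ t v u rest f → 𝔼 (rebalanceZig p t (v ∷ u ∷ rest)) f ≡
      (1ℚ - p) * f (rotateUp v t) + p * 𝔼 (rebalanceZig p t (u ∷ rest)) f
    𝔼-rebalanceZig-∷ t v u rest f = cong ((1ℚ - p) * f (rotateUp v t) +_) (𝔼-scale p (rebalanceZig p t (u ∷ rest)) f)

    𝔼-rebalanceZig-root : ∀ t w f → 𝔼 (rebalanceZig p t (w ∷ [])) f ≡ f t
    𝔼-rebalanceZig-root t w f = ≡-trans (+-identityʳ _) (*-identityˡ _)

    𝔼-rebalanceZig-child : ∀ t c r f → 𝔼 (rebalanceZig p t (c ∷ r ∷ [])) f ≡ (1ℚ - p) * f (rotateUp c t) + p * f t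
    𝔼-rebalanceZig-child t c r f =
      ≡-trans (𝔼-rebalanceZig-∷ t c r [] f) (cong (λ e → (1ℚ - p) * f (rotateUp c t) + p * e) (𝔼-rebalanceZig-root t r f))

    𝔼-rebalanceZig-++ : ∀ t v vs w rest f → 𝔼 (rebalanceZig p t (v ∷ vs ++ w ∷ rest)) f ≡
      (1ℚ - p) * f (rotateUp v t) + p * 𝔼 (rebalanceZig p t (vs ++ w ∷ rest)) f
    𝔼-rebalanceZig-++ t v []       w rest f = 𝔼-rebalanceZig-∷ t v w rest f
    𝔼-rebalanceZig-++ t v (u ∷ vs) w rest f = 𝔼-rebalanceZig-∷ t v u (vs ++ w ∷ rest) f

    𝔼-rebalanceZig-walk : ∀ t {f a} vs r → All (λ v → f (rotateUp v t) ≡ a) vs →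
      𝔼 (rebalanceZig p t (vs ++ r ∷ [])) f ≡ (1ℚ - p ^ length vs) * a + p ^ length vs * f t
    𝔼-rebalanceZig-walk t {f} {a} [] r [] = ≡-trans (𝔼-rebalanceZig-root t r f)
      (solve 2 (λ a b → b := (con 1ℚ :- con 1ℚ) :* a :+ con 1ℚ :* b) refl a (f t))
    𝔼-rebalanceZig-walk t {f} {a} (v ∷ vs) r (fv≡a ∷ fvs≡a) = begin
      𝔼 (rebalanceZig p t (v ∷ vs ++ r ∷ [])) f
        ≡⟨ 𝔼-rebalanceZig-++ t v vs r [] f ⟩
      (1ℚ - p) * f (rotateUp v t) + p * 𝔼 (rebalanceZig p t (vs ++ r ∷ [])) f
        ≡⟨ cong₂ (λ b c → (1ℚ - p) * b + p * c) fv≡a (𝔼-rebalanceZig-walk t vs r fvs≡a) ⟩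
      (1ℚ - p) * a + p * ((1ℚ - P) * a + P * f t)
        ≡⟨ solve 4 (λ p a P b → (con 1ℚ :- p) :* a :+ p :* ((con 1ℚ :- P) :* a :+ P :* b)
                             := (con 1ℚ :- p :* P) :* a :+ p :* P :* b) refl p a P (f t) ⟩
      (1ℚ - p * P) * a + p * P * f t
        ∎
      where
      open ≡-Reasoning
      P = p ^ length vs

    𝔼-Φright-walkUp : ∀ A s Z → AllPairs _<_ (s ∷ spineKeys Z) →
      𝔼 (rebalanceZig p (graft ((A , s) ∷ Z) leaf) (reverse (spineKeys Z) ++ s ∷ [])) Φright ≡ ℕtoℚ (length Z) + p ^ length Z
    𝔼-Φright-walkUp A s Z asc = begin
      𝔼 (rebalanceZig p T (reverse (spineKeys Z) ++ s ∷ [])) Φright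
        ≡⟨ 𝔼-rebalanceZig-walk T (reverse (spineKeys Z)) s (All-reverse⁺ (All.map shortened (rotateUp-spineKey A s Z asc))) ⟩
      (1ℚ - p ^ length (reverse (spineKeys Z))) * n + p ^ length (reverse (spineKeys Z)) * Φright T
        ≡⟨ cong₂ (λ k b → (1ℚ - p ^ k) * n + p ^ k * b) (length-reverse-spineKeys Z)
                 (≡-trans (Φright-graft-leaf ((A , s) ∷ Z)) (ℕtoℚ-suc (length Z))) ⟩
      (1ℚ - P) * n + P * (1ℚ + n)
        ≡⟨ solve 2 (λ n P → (con 1ℚ :- P) :* n :+ P :* (con 1ℚ :+ n) := n :+ P) refl n P ⟩
      n + P
        ∎
      where
      open ≡-Reasoning
      T = graft ((A , s) ∷ Z) leaf
      n = ℕtoℚ (length Z)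
      P = p ^ length Z
      shortened : ∀ {v} → _ → Φright (rotateUp v T) ≡ n
      shortened (Z′ , |Z′| , rot) = ≡-trans (cong Φright (rot leaf)) (≡-trans (Φright-graft-leaf Z′) (cong ℕtoℚ |Z′|))

    𝔼-Φright-walkFromBottom : ∀ S Y M → AllPairs _<_ (spineKeys S) → All (_< M) (spineKeys S) →
      𝔼 (rebalanceZig p (graft S (node Y M leaf)) (M ∷ reverse (spineKeys S))) Φright ≡ ℕtoℚ (length S) + p ^ length S
    𝔼-Φright-walkFromBottom []            Y M _   _     = 𝔼-rebalanceZig-root (node Y M leaf) M Φright
    𝔼-Φright-walkFromBottom ((A , s) ∷ S) Y M asc below = begin
      𝔼 (rebalanceZig p (graft ((A , s) ∷ S) (node Y M leaf)) (M ∷ reverse (s ∷ spineKeys S))) Φright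
        ≡⟨ cong₂ (λ T path → 𝔼 (rebalanceZig p T path) Φright) tree path ⟩
      𝔼 (rebalanceZig p (graft ((A , s) ∷ Z) leaf) (reverse (spineKeys Z) ++ s ∷ [])) Φright
        ≡⟨ 𝔼-Φright-walkUp A s Z (subst (AllPairs _<_) (cong (s ∷_) (≡-sym keysZ)) (AllPairs-∷ʳ asc below)) ⟩
      ℕtoℚ (length Z) + p ^ length Z
        ≡⟨ cong (λ k → ℕtoℚ k + p ^ k) (≡-trans (length-++ S) (ℕ.+-comm (length S) 1)) ⟩
      ℕtoℚ (suc (length S)) + p ^ suc (length S)
        ∎
      where
      open ≡-Reasoning
      Z = S ++ [ (Y , M) ]
      keysZ : spineKeys Z ≡ spineKeys S ++ [ M ]
      keysZ = map-++ proj₂ S [ (Y , M) ]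
      tree : graft ((A , s) ∷ S) (node Y M leaf) ≡ graft ((A , s) ∷ Z) leaf
      tree = cong (node A s) (≡-sym (graft-++ S [ (Y , M) ] leaf))
      path : M ∷ reverse (s ∷ spineKeys S) ≡ reverse (spineKeys Z) ++ s ∷ []
      path = begin
        M ∷ reverse (s ∷ spineKeys S)          ≡⟨ cong (M ∷_) (unfold-reverse s (spineKeys S)) ⟩
        M ∷ reverse (spineKeys S) ++ s ∷ []
          ≡⟨ cong (_++ s ∷ []) (≡-trans (cong reverse keysZ) (reverse-++ (spineKeys S) [ M ])) ⟨
        reverse (spineKeys Z) ++ s ∷ []        ∎

    module _ (0≤p : 0ℚ ≤ p) (p≤1 : p ≤ 1ℚ) where

      rebalanceZig-ProbOn : ∀ {P} t path → P t → All (λ v → P (rotateUp v t)) path → ProbOn P (rebalanceZig p t path)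
      rebalanceZig-ProbOn t []             Pt _ = (≤-trans 0≤p p≤1 , Pt) ∷ [] , refl
      rebalanceZig-ProbOn t (v ∷ [])       Pt _ = (≤-trans 0≤p p≤1 , Pt) ∷ [] , refl
      rebalanceZig-ProbOn t (v ∷ u ∷ rest) Pt (Pv ∷ Prest) =
        (p≤q⇒0≤q-p p≤1 , Pv) ∷ NonNegOn-scale 0≤p (proj₁ prob) ,
        ≡-trans (𝔼-rebalanceZig-∷ t v u rest (λ _ → 1ℚ))
          (≡-trans (cong (λ m → (1ℚ - p) * 1ℚ + p * m) (proj₂ prob))
            (solve 1 (λ p → (con 1ℚ :- p) :* con 1ℚ :+ p :* con 1ℚ := con 1ℚ) refl p))
        where
        prob = rebalanceZig-ProbOn t (u ∷ rest) Pt Prest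

      𝔼-rebalanceZig-gain : ∀ t {f a} vs c r →
        All (λ v → a ≤ f (rotateUp v t)) vs → a + 1ℚ ≤ f (rotateUp c t) → a ≤ f t →
        a + (1ℚ - p) * p ^ length vs ≤ 𝔼 (rebalanceZig p t (vs ++ c ∷ r ∷ [])) f
      𝔼-rebalanceZig-gain t {f} {a} [] c r _ gain a≤ft = begin
        a + (1ℚ - p) * 1ℚ
          ≡⟨ solve 2 (λ p a → a :+ (con 1ℚ :- p) :* con 1ℚ := (con 1ℚ :- p) :* (a :+ con 1ℚ) :+ p :* a) refl p a ⟩
        (1ℚ - p) * (a + 1ℚ) + p * a
          ≤⟨ +-mono-≤ (*-monoˡ-≤-nonNeg′ (p≤q⇒0≤q-p p≤1) gain) (*-monoˡ-≤-nonNeg′ 0≤p a≤ft) ⟩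
        (1ℚ - p) * f (rotateUp c t) + p * f t
          ≡⟨ 𝔼-rebalanceZig-child t c r f ⟨
        𝔼 (rebalanceZig p t (c ∷ r ∷ [])) f
          ∎
        where open ≤-Reasoning
      𝔼-rebalanceZig-gain t {f} {a} (v ∷ vs) c r (a≤fv ∷ a≤fvs) gain a≤ft = begin
        a + (1ℚ - p) * (p * P)
          ≡⟨ solve 3 (λ p a P → a :+ (con 1ℚ :- p) :* (p :* P)
                               := (con 1ℚ :- p) :* a :+ p :* (a :+ (con 1ℚ :- p) :* P)) refl p a P ⟩
        (1ℚ - p) * a + p * (a + (1ℚ - p) * P)
          ≤⟨ +-mono-≤ (*-monoˡ-≤-nonNeg′ (p≤q⇒0≤q-p p≤1) a≤fv)
                      (*-monoˡ-≤-nonNeg′ 0≤p (𝔼-rebalanceZig-gain t vs c r a≤fvs gain a≤ft)) ⟩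
        (1ℚ - p) * f (rotateUp v t) + p * 𝔼 (rebalanceZig p t (vs ++ c ∷ r ∷ [])) f
          ≡⟨ 𝔼-rebalanceZig-++ t v vs c (r ∷ []) f ⟨
        𝔼 (rebalanceZig p t (v ∷ vs ++ c ∷ r ∷ [])) f
          ∎
        where
        open ≤-Reasoning
        P = p ^ length vs

  𝔼-rebalanceZig₀ : ∀ t v u rest f → 𝔼 (rebalanceZig 0ℚ t (v ∷ u ∷ rest)) f ≡ f (rotateUp v t)
  𝔼-rebalanceZig₀ t v u rest f = ≡-trans (Walk.𝔼-rebalanceZig-∷ 0ℚ t v u rest f)
    (solve 2 (λ a b → (con 1ℚ :- con 0ℚ) :* a :+ con 0ℚ :* b := a) refl
           (f (rotateUp v t)) (𝔼 (rebalanceZig 0ℚ t (u ∷ rest)) f))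

open Walks


module PairInsertion where

  open import Data.Nat using (ℕ; _<_)
  open import Data.Nat.Properties using (<⇒≢; >⇒≢)
  open import Data.Rational using (ℚ)
  open import Data.List using ([]; _∷_; _++_; reverse)
  open import Data.List.Properties using (reverse-++)
  open import Data.List.Relation.Unary.All using (All)
  open import Relation.Binary.PropositionalEquality
    using (_≡_; cong; subst; module ≡-Reasoning)
    renaming (sym to ≡-sym; trans to ≡-trans)

  insertPair : ℚ → ℕ → ℕ → Tree → Dist Tree
  insertPair p M x t = bindDist (insertZig p M t) (insertZig p x)

  insertZig-graft : ∀ p x S t → All (_< x) (spineKeys S) →
    insertZig p x (graft S t) ≡ rebalanceZig p (graft S (insert x t)) (reverse (searchPath x (insert x t)) ++ reverse (spineKeys S))
  insertZig-graft p x S t below = begin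
    rebalanceZig p (insert x (graft S t)) (reverse (searchPath x (insert x (graft S t))))
      ≡⟨ cong (λ t′ → rebalanceZig p t′ (reverse (searchPath x t′))) (insert-graft S t below) ⟩
    rebalanceZig p (graft S (insert x t)) (reverse (searchPath x (graft S (insert x t))))
      ≡⟨ cong (λ path → rebalanceZig p (graft S (insert x t)) (reverse path)) (searchPath-graft S (insert x t) below) ⟩
    rebalanceZig p (graft S (insert x t)) (reverse (spineKeys S ++ searchPath x (insert x t)))
      ≡⟨ cong (rebalanceZig p (graft S (insert x t))) (reverse-++ (spineKeys S) (searchPath x (insert x t))) ⟩
    rebalanceZig p (graft S (insert x t)) (reverse (searchPath x (insert x t)) ++ reverse (spineKeys S))
      ∎
    where open ≡-Reasoning

  module Pair (p : ℚ) {x M : ℕ} (x<M : x < M) where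

    insertZig-max : ∀ S → All (_< M) (spineKeys S) →
      insertZig p M (graft S leaf) ≡ rebalanceZig p (graft S (node leaf M leaf)) (M ∷ reverse (spineKeys S))
    insertZig-max S below = ≡-trans (insertZig-graft p M S leaf below)
      (cong (λ path → rebalanceZig p (graft S (node leaf M leaf)) (reverse path ++ reverse (spineKeys S)))
            (searchPath-root leaf leaf))

    𝔼-insertPair-max : ∀ S f → All (_< M) (spineKeys S) →
      𝔼 (insertPair p M x (graft S leaf)) f ≡
      𝔼 (rebalanceZig p (graft S (node leaf M leaf)) (M ∷ reverse (spineKeys S))) (λ t → 𝔼 (insertZig p x t) f)
    𝔼-insertPair-max S f below = ≡-trans (𝔼-bind (insertZig p M (graft S leaf)) (insertZig p x) f)
      (cong (λ d → 𝔼 d (λ t → 𝔼 (insertZig p x t) f)) (insertZig-max S below))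

    IsBST-graft-max : ∀ S → All (_< M) (spineKeys S) → IsBST (graft S leaf) → IsBST (graft S (node leaf M leaf))
    IsBST-graft-max S below bst = subst IsBST (insert-graft S leaf below) (IsBST-insert M _ bst)

    insertZig-max-below : ∀ S A {s} → All (_< M) (spineKeys S) → s < M →
      insertZig p M (graft S (node A s leaf)) ≡ rebalanceZig p (graft S (node A s (node leaf M leaf))) (M ∷ s ∷ reverse (spineKeys S))
    insertZig-max-below S A {s} below s<M = begin
      insertZig p M (graft S (node A s leaf))
        ≡⟨ insertZig-graft p M S (node A s leaf) below ⟩
      rebalanceZig p (graft S (insert M (node A s leaf))) (reverse (searchPath M (insert M (node A s leaf))) ++ keys)
        ≡⟨ cong (λ t → rebalanceZig p (graft S t) (reverse (searchPath M t) ++ keys)) (insert-> A leaf s<M) ⟩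
      rebalanceZig p (graft S (node A s (node leaf M leaf))) (reverse (searchPath M (node A s (node leaf M leaf))) ++ keys)
        ≡⟨ cong (λ path → rebalanceZig p (graft S (node A s (node leaf M leaf))) (reverse path ++ keys))
                (≡-trans (searchPath-> A (node leaf M leaf) s<M) (cong (s ∷_) (searchPath-root leaf leaf))) ⟩
      rebalanceZig p (graft S (node A s (node leaf M leaf))) (M ∷ s ∷ keys)
        ∎
      where
      open ≡-Reasoning
      keys = reverse (spineKeys S)

    rotateUp-max : ∀ S A {s} → All (_< M) (spineKeys S) → s < M →
      rotateUp M (graft S (node A s (node leaf M leaf))) ≡ graft S (node (node A s leaf) M leaf)
    rotateUp-max S A below s<M =
      ≡-trans (rotateUp-graft S _ below (<⇒≢ s<M)) (cong (graft S) (rotateUp-rightChild A leaf leaf s<M))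

    rotateUp-leftOfBottom : ∀ S {y} B C → All (_< y) (spineKeys S) → y < M →
      rotateUp y (graft S (node (node B y C) M leaf)) ≡ graft S (node B y (node C M leaf))
    rotateUp-leftOfBottom S B C below y<M =
      ≡-trans (rotateUp-graft S _ below (>⇒≢ y<M)) (cong (graft S) (rotateUp-leftChild B C leaf y<M))

    insertZig-underMax : ∀ S → All (_< x) (spineKeys S) →
      insertZig p x (graft S (node leaf M leaf)) ≡
      rebalanceZig p (graft S (node (node leaf x leaf) M leaf)) (x ∷ M ∷ reverse (spineKeys S))
    insertZig-underMax S below = begin
      insertZig p x (graft S (node leaf M leaf))
        ≡⟨ insertZig-graft p x S _ below ⟩
      rebalanceZig p (graft S (insert x (node leaf M leaf))) (reverse (searchPath x (insert x (node leaf M leaf))) ++ keys)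
        ≡⟨ cong (λ t → rebalanceZig p (graft S t) (reverse (searchPath x t) ++ keys)) (insert-< leaf leaf x<M) ⟩
      rebalanceZig p (graft S (node (node leaf x leaf) M leaf)) (reverse (searchPath x (node (node leaf x leaf) M leaf)) ++ keys)
        ≡⟨ cong (λ path → rebalanceZig p (graft S (node (node leaf x leaf) M leaf)) (reverse path ++ keys))
                (≡-trans (searchPath-< (node leaf x leaf) leaf x<M) (cong (M ∷_) (searchPath-root leaf leaf))) ⟩
      rebalanceZig p (graft S (node (node leaf x leaf) M leaf)) (x ∷ M ∷ keys)
        ∎
      where
      open ≡-Reasoning
      keys = reverse (spineKeys S)

    insertZig-underMaxLeft : ∀ S A {s} → All (_< x) (spineKeys S) → s < x →
      insertZig p x (graft S (node (node A s leaf) M leaf)) ≡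
      rebalanceZig p (graft S (node (node A s (node leaf x leaf)) M leaf)) (x ∷ s ∷ M ∷ reverse (spineKeys S))
    insertZig-underMaxLeft S A {s} below s<x = begin
      insertZig p x (graft S t)
        ≡⟨ insertZig-graft p x S t below ⟩
      rebalanceZig p (graft S (insert x t)) (reverse (searchPath x (insert x t)) ++ keys)
        ≡⟨ cong (λ t → rebalanceZig p (graft S t) (reverse (searchPath x t) ++ keys)) inserted ⟩
      rebalanceZig p (graft S t′) (reverse (searchPath x t′) ++ keys)
        ≡⟨ cong (λ path → rebalanceZig p (graft S t′) (reverse path ++ keys)) path ⟩
      rebalanceZig p (graft S t′) (x ∷ s ∷ M ∷ keys)
        ∎
      where
      open ≡-Reasoning
      keys = reverse (spineKeys S)
      t  = node (node A s leaf) M leaf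
      t′ = node (node A s (node leaf x leaf)) M leaf
      inserted : insert x t ≡ t′
      inserted = ≡-trans (insert-< (node A s leaf) leaf x<M) (cong (λ l → node l M leaf) (insert-> A leaf s<x))
      path : searchPath x t′ ≡ M ∷ s ∷ x ∷ []
      path = ≡-trans (searchPath-< (node A s (node leaf x leaf)) leaf x<M)
               (cong (M ∷_) (≡-trans (searchPath-> A (node leaf x leaf) s<x) (cong (s ∷_) (searchPath-root leaf leaf))))

    rotateUp-underMaxLeft : ∀ S A {s} → All (_< x) (spineKeys S) → s < x →
      rotateUp x (graft S (node (node A s (node leaf x leaf)) M leaf)) ≡ graft S (node (node (node A s leaf) x leaf) M leaf)
    rotateUp-underMaxLeft S A below s<x =
      ≡-trans (rotateUp-graft S _ below (>⇒≢ x<M))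
        (cong (graft S) (≡-trans (rotateUp-inLeft _ leaf x<M (<⇒≢ s<x))
                                 (cong (λ l → node l M leaf) (rotateUp-rightChild A leaf leaf s<x))))

open PairInsertion


module RightSpineDrift where

  open import Data.Nat as ℕ using (ℕ; suc; _<_)
  import Data.Nat.Properties as ℕ
  open import Data.Rational as ℚ using (ℚ; 0ℚ; 1ℚ; _+_; _*_; _-_; _≤_)
  open import Data.Rational.Properties using (≤-trans; +-monoˡ-≤; nonNegative⁻¹)
  open import Data.Rational.Solver using (module +-*-Solver)
  open import Data.List using ([]; _∷_; _++_; length; reverse; [_])
  open import Data.List.Properties using (unfold-reverse; length-++)
  open import Data.List.Relation.Unary.All as All using (All)
  open import Data.Product using (_,_; proj₁; proj₂)
  open import Relation.Binary.PropositionalEquality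
    using (_≡_; refl; cong; cong₂; subst; module ≡-Reasoning)
    renaming (sym to ≡-sym; trans to ≡-trans)
  open +-*-Solver

  spineDrift : ℚ → ℚ → ℚ
  spineDrift p X = p * (1ℚ - 2ℚ * p) * (2ℚ - p) + (1ℚ + 2ℚ * p - p * p) * X - (1ℚ - p) * (X * X)

  spineDrift-lowerBound : ∀ {p X} → 0ℚ ≤ p → p ≤ 1ℚ → 0ℚ ≤ X → X ≤ 1ℚ →
    p * (1ℚ - 2ℚ * p) * (2ℚ - p) ≤ spineDrift p X
  spineDrift-lowerBound {p} {X} 0≤p p≤1 0≤X X≤1 = ≤-by-nonNeg-gap (X * (p * (2ℚ + 1ℚ - p) + (1ℚ - p) * (1ℚ - X)))
    (solve 2 (λ p X → p :* (con 1ℚ :- con 2ℚ :* p) :* (con 2ℚ :- p)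
                      :+ (con 1ℚ :+ con 2ℚ :* p :- p :* p) :* X :- (con 1ℚ :- p) :* (X :* X)
                   := p :* (con 1ℚ :- con 2ℚ :* p) :* (con 2ℚ :- p)
                      :+ X :* (p :* (con 2ℚ :+ con 1ℚ :- p) :+ (con 1ℚ :- p) :* (con 1ℚ :- X)))
       refl p X)
    (*-nonNeg 0≤X (+-nonNeg (*-nonNeg 0≤p (p≤q⇒0≤q-p (≤-trans p≤1 (+-monoˡ-≤ 1ℚ (nonNegative⁻¹ 2ℚ)))))
                            (*-nonNeg (p≤q⇒0≤q-p p≤1) (p≤q⇒0≤q-p X≤1))))

  module _ (p : ℚ) {x M : ℕ} (x<M : x < M) where
    open Walk p
    open Pair p x<M

    𝔼-Φright-insertZig-underMax : ∀ S → IsBST (graft S leaf) → AllKeys (_< x) (graft S leaf) →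
      𝔼 (insertZig p x (graft S (node leaf M leaf))) Φright ≡
      (1ℚ - p) * (ℕtoℚ (length S) + 2ℚ) + p * (ℕtoℚ (length S) + p ^ length S)
    𝔼-Φright-insertZig-underMax S bst below = begin
      𝔼 (insertZig p x (graft S (node leaf M leaf))) Φright
        ≡⟨ cong (λ d → 𝔼 d Φright) (insertZig-underMax S S<x) ⟩
      𝔼 (rebalanceZig p T (x ∷ M ∷ reverse (spineKeys S))) Φright
        ≡⟨ 𝔼-rebalanceZig-∷ T x M (reverse (spineKeys S)) Φright ⟩
      (1ℚ - p) * Φright (rotateUp x T) + p * 𝔼 (rebalanceZig p T (M ∷ reverse (spineKeys S))) Φright
        ≡⟨ cong₂ (λ a b → (1ℚ - p) * a + p * b)
             (≡-trans (cong Φright (rotateUp-leftOfBottom S leaf leaf S<x x<M)) (Φright-graft S _))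
             (𝔼-Φright-walkFromBottom S (node leaf x leaf) M (IsBST-graft S leaf bst) S<M) ⟩
      (1ℚ - p) * (ℕtoℚ (length S) + 2ℚ) + p * (ℕtoℚ (length S) + p ^ length S)
        ∎
      where
      open ≡-Reasoning
      T = graft S (node (node leaf x leaf) M leaf)
      S<x = AllKeys-graft S leaf below
      S<M = All.map (λ k<x → ℕ.<-trans k<x x<M) S<x

    𝔼-Φright-insertZig-afterMaxRotation : ∀ S A s →
      IsBST (graft S (node A s leaf)) → AllKeys (_< x) (graft S (node A s leaf)) →
      𝔼 (insertZig p x (rotateUp M (graft S (node A s (node leaf M leaf))))) Φright ≡
      (1ℚ - p) * (ℕtoℚ (length S) + 1ℚ) + p * ((1ℚ - p) * (ℕtoℚ (length S) + 2ℚ) + p * (ℕtoℚ (length S) + p ^ length S))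
    𝔼-Φright-insertZig-afterMaxRotation S A s bst below = begin
      𝔼 (insertZig p x (rotateUp M (graft S (node A s (node leaf M leaf))))) Φright
        ≡⟨ cong (λ t → 𝔼 (insertZig p x t) Φright) (rotateUp-max S A S<M s<M) ⟩
      𝔼 (insertZig p x (graft S (node (node A s leaf) M leaf))) Φright
        ≡⟨ cong (λ d → 𝔼 d Φright) (insertZig-underMaxLeft S A S<x s<x) ⟩
      𝔼 (rebalanceZig p T (x ∷ s ∷ M ∷ reverse (spineKeys S))) Φright
        ≡⟨ 𝔼-rebalanceZig-∷ T x s (M ∷ reverse (spineKeys S)) Φright ⟩
      (1ℚ - p) * Φright (rotateUp x T) + p * 𝔼 (rebalanceZig p T (s ∷ M ∷ reverse (spineKeys S))) Φright
        ≡⟨ cong (λ e → (1ℚ - p) * Φright (rotateUp x T) + p * e) (𝔼-rebalanceZig-∷ T s M (reverse (spineKeys S)) Φright) ⟩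
      (1ℚ - p) * Φright (rotateUp x T)
        + p * ((1ℚ - p) * Φright (rotateUp s T) + p * 𝔼 (rebalanceZig p T (M ∷ reverse (spineKeys S))) Φright)
        ≡⟨ cong₂ (λ a b → (1ℚ - p) * a + p * b)
             (≡-trans (cong Φright (rotateUp-underMaxLeft S A S<x s<x)) (Φright-graft S _))
             (cong₂ (λ a b → (1ℚ - p) * a + p * b)
               (≡-trans (cong Φright (rotateUp-leftOfBottom S A (node leaf x leaf) S<s s<M)) (Φright-graft S _))
               (𝔼-Φright-walkFromBottom S (node A s (node leaf x leaf)) M (IsBST-graft S _ bst) S<M)) ⟩
      (1ℚ - p) * (ℕtoℚ (length S) + 1ℚ) + p * ((1ℚ - p) * (ℕtoℚ (length S) + 2ℚ) + p * (ℕtoℚ (length S) + p ^ length S))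
        ∎
      where
      open ≡-Reasoning
      T = graft S (node (node A s (node leaf x leaf)) M leaf)
      S<x = AllKeys-graft S _ below
      s<x = proj₁ (proj₂ (AllKeys-graft-tail S _ below))
      s<M = ℕ.<-trans s<x x<M
      S<M = All.map (λ k<x → ℕ.<-trans k<x x<M) S<x
      S<s = All.map (λ k<tail → proj₁ (proj₂ k<tail)) (IsBST-graft-keys<tail S _ bst)

    𝔼-Φright-insertPair : ∀ A₀ s₀ Z →
      IsBST (graft ((A₀ , s₀) ∷ Z) leaf) → AllKeys (_< x) (graft ((A₀ , s₀) ∷ Z) leaf) →
      𝔼 (insertPair p M x (graft ((A₀ , s₀) ∷ Z) leaf)) Φright ≡
      Φright (graft ((A₀ , s₀) ∷ Z) leaf) + spineDrift p (p ^ suc (length Z))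
    𝔼-Φright-insertPair A₀ s₀ Z bst below = begin
      𝔼 (insertPair p M x T) Φright
        ≡⟨ 𝔼-insertPair-max ((A₀ , s₀) ∷ Z) Φright (All.map (λ k<x → ℕ.<-trans k<x x<M) (AllKeys-graft _ leaf below)) ⟩
      𝔼 (rebalanceZig p T′ (M ∷ reverse (s₀ ∷ spineKeys Z))) G
        ≡⟨ cong (λ path → 𝔼 (rebalanceZig p T′ (M ∷ path)) G) (unfold-reverse s₀ (spineKeys Z)) ⟩
      𝔼 (rebalanceZig p T′ (M ∷ reverse (spineKeys Z) ++ s₀ ∷ [])) G
        ≡⟨ 𝔼-rebalanceZig-++ T′ M (reverse (spineKeys Z)) s₀ [] G ⟩
      (1ℚ - p) * G (rotateUp M T′) + p * 𝔼 (rebalanceZig p T′ (reverse (spineKeys Z) ++ s₀ ∷ [])) G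
        ≡⟨ cong₂ (λ a b → (1ℚ - p) * a + p * b) afterMaxRotation
             (𝔼-rebalanceZig-walk T′ (reverse (spineKeys Z)) s₀
               (All-reverse⁺ (All.map afterSpineRotation (rotateUp-spineKey A₀ s₀ Z (IsBST-graft _ leaf bst))))) ⟩
      (1ℚ - p) * GB + p * ((1ℚ - p ^ length (reverse (spineKeys Z))) * GA + p ^ length (reverse (spineKeys Z)) * G T′)
        ≡⟨ cong₂ (λ k b → (1ℚ - p) * GB + p * ((1ℚ - p ^ k) * GA + p ^ k * b)) (length-reverse-spineKeys Z)
             (≡-trans (𝔼-Φright-insertZig-underMax ((A₀ , s₀) ∷ Z) bst below)
                      (cong (λ m → (1ℚ - p) * (m + 2ℚ) + p * (m + p * P)) (ℕtoℚ-suc k))) ⟩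
      (1ℚ - p) * GB + p * ((1ℚ - P) * GA + P * ((1ℚ - p) * ((1ℚ + n) + 2ℚ) + p * ((1ℚ + n) + p * P)))
        ≡⟨ solve 3 (λ p n P →
             (con 1ℚ :- p) :* ((con 1ℚ :- p) :* (n :+ con 1ℚ) :+ p :* ((con 1ℚ :- p) :* (n :+ con 2ℚ) :+ p :* (n :+ P)))
             :+ p :* ((con 1ℚ :- P) :* ((con 1ℚ :- p) :* (n :+ con 2ℚ) :+ p :* (n :+ P))
                      :+ P :* ((con 1ℚ :- p) :* ((con 1ℚ :+ n) :+ con 2ℚ) :+ p :* ((con 1ℚ :+ n) :+ p :* P)))
             := (con 1ℚ :+ n) :+ (p :* (con 1ℚ :- con 2ℚ :* p) :* (con 2ℚ :- p) :+ (con 1ℚ :+ con 2ℚ :* p :- p :* p) :* (p :* P)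
                                  :- (con 1ℚ :- p) :* ((p :* P) :* (p :* P))))
             refl p n P ⟩
      (1ℚ + n) + spineDrift p (p * P)
        ≡⟨ cong (_+ spineDrift p (p * P)) (≡-trans (Φright-graft-leaf ((A₀ , s₀) ∷ Z)) (ℕtoℚ-suc k)) ⟨
      Φright T + spineDrift p (p * P)
        ∎
      where
      open ≡-Reasoning
      T  = graft ((A₀ , s₀) ∷ Z) leaf
      T′ = graft ((A₀ , s₀) ∷ Z) (node leaf M leaf)
      G : Tree → ℚ
      G t = 𝔼 (insertZig p x t) Φright
      k = length Z
      n = ℕtoℚ k
      P = p ^ k
      GA-at GB-at : ℕ → ℚ
      GA-at m = (1ℚ - p) * (ℕtoℚ m + 2ℚ) + p * (ℕtoℚ m + p ^ m)
      GB-at m = (1ℚ - p) * (ℕtoℚ m + 1ℚ) + p * GA-at m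
      GA = GA-at k
      GB = GB-at k
      afterSpineRotation : ∀ {v} → _ → G (rotateUp v T′) ≡ GA
      afterSpineRotation {v} (Z′ , |Z′| , rot) = begin
        G (rotateUp v T′)
          ≡⟨ cong G (rot (node leaf M leaf)) ⟩
        G (graft Z′ (node leaf M leaf))
          ≡⟨ 𝔼-Φright-insertZig-underMax Z′ (subst IsBST (rot leaf) (IsBST-rotateUp v T bst))
                                           (subst (AllKeys (_< x)) (rot leaf) (AllKeys-rotateUp v T below)) ⟩
        GA-at (length Z′)
          ≡⟨ cong GA-at |Z′| ⟩
        GA
          ∎
      afterMaxRotation : G (rotateUp M T′) ≡ GB
      afterMaxRotation with snoc-view (A₀ , s₀) Z
      ... | S , (A , s) , split = begin
        G (rotateUp M T′)                            ≡⟨ cong (λ t → G (rotateUp M t)) (graft-split (node leaf M leaf)) ⟩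
        G (rotateUp M (graft S (node A s (node leaf M leaf))))
          ≡⟨ 𝔼-Φright-insertZig-afterMaxRotation S A s
               (subst IsBST (graft-split leaf) bst) (subst (AllKeys (_< x)) (graft-split leaf) below) ⟩
        GB-at (length S)
          ≡⟨ cong GB-at |S| ⟩
        GB                                           ∎
        where
        graft-split : ∀ t → graft ((A₀ , s₀) ∷ Z) t ≡ graft S (node A s t)
        graft-split t = ≡-trans (cong (λ S′ → graft S′ t) split) (graft-++ S [ (A , s) ] t)
        |S| : length S ≡ k
        |S| = ℕ.suc-injective (≡-sym (≡-trans (cong length split) (≡-trans (length-++ S) (ℕ.+-comm (length S) 1))))

open RightSpineDrift


module LeftSpineDrift where

  open import Data.Nat as ℕ using (ℕ; suc; _<_)
  import Data.Nat.Properties as ℕ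
  open import Data.Rational as ℚ using (ℚ; 0ℚ; 1ℚ; _+_; _*_; _-_; _≤_)
  open import Data.Rational.Properties
  open import Data.Rational.Solver using (module +-*-Solver)
  open import Data.List using ([]; _∷_; _++_; length; reverse)
  open import Data.List.Properties using (reverse-++)
  open import Data.List.Relation.Unary.All as All using (All; []; _∷_)
  open import Data.Product using (_,_; proj₁; proj₂)
  open import Relation.Binary.PropositionalEquality
    using (_≡_; refl; cong; cong₂; subst; subst₂)
    renaming (sym to ≡-sym; trans to ≡-trans)
  open +-*-Solver

  Φleft : Tree → ℚ
  Φleft t = ℕtoℚ (leftSpineLength t)

  module _ (p : ℚ) (0≤p : 0ℚ ≤ p) (p≤1 : p ≤ 1ℚ) {x M : ℕ} (x<M : x < M) where
    open Walk p
    open Pair p x<M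

    Φleft-insertZig-mono : ∀ A {r} R → r < x → IsBST (node A r R) →
      Φleft (node A r R) ≤ 𝔼 (insertZig p x (node A r R)) Φleft
    Φleft-insertZig-mono A {r} R r<x (_ , r<R , _) =
      subst (λ t → Φleft (node A r R) ≤ 𝔼 (rebalanceZig p t (reverse (searchPath x t))) Φleft) (≡-sym (insert-> A R r<x))
        (𝔼-lowerBound (Φleft (node A r R))
          (rebalanceZig-ProbOn 0≤p p≤1 T (reverse (searchPath x T)) ≤-refl (All-reverse⁺ (All.map rotated path≥r)))
          (λ _ h → h))
      where
      T = node A r (insert x R)
      path≥r : All (r ℕ.≤_) (searchPath x T)
      path≥r = subst (All (r ℕ.≤_)) (≡-sym (searchPath-> A (insert x R) r<x))
                 (ℕ.≤-refl ∷ searchPath-AllKeys x _ (AllKeys-map ℕ.<⇒≤ _ (AllKeys-insert R r<x r<R)))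
      rotated : ∀ {v} → r ℕ.≤ v → Φleft (node A r R) ≤ Φleft (rotateUp v T)
      rotated {v} r≤v = ℕtoℚ-mono-≤ (leftSpineLength-rotateUp v A r (insert x R) r≤v)

    Φleft-afterMaxRotation : ∀ A {s} → s < x →
      Φleft (node A s leaf) + 1ℚ ≤ 𝔼 (insertZig p x (rotateUp M (node A s (node leaf M leaf)))) Φleft
    Φleft-afterMaxRotation A {s} s<x = begin
      a + 1ℚ
        ≤⟨ ≤-by-nonNeg-gap ((1ℚ - p) * (1ℚ - p))
             (solve 2 (λ p a → (con 1ℚ :- p) :* (con 1ℚ :+ (con 1ℚ :+ a)) :+ p :* ((con 1ℚ :- p) :* a :+ p :* (con 1ℚ :+ a))
                              := a :+ con 1ℚ :+ (con 1ℚ :- p) :* (con 1ℚ :- p)) refl p a)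
             (square-nonNeg (1ℚ - p)) ⟩
      (1ℚ - p) * (1ℚ + (1ℚ + a)) + p * ((1ℚ - p) * a + p * (1ℚ + a))
        ≡⟨ cong₂ (λ b c → (1ℚ - p) * b + p * c) x-rotated
                 (cong₂ (λ b c → (1ℚ - p) * b + p * c) s-rotated unrotated) ⟨
      (1ℚ - p) * Φleft (rotateUp x T) + p * ((1ℚ - p) * Φleft (rotateUp s T) + p * Φleft T)
        ≡⟨ ≡-trans (𝔼-rebalanceZig-∷ T x s (M ∷ []) Φleft)
                   (cong (λ e → (1ℚ - p) * Φleft (rotateUp x T) + p * e) (𝔼-rebalanceZig-child T s M Φleft)) ⟨
      𝔼 (rebalanceZig p T (x ∷ s ∷ M ∷ [])) Φleft
        ≡⟨ ≡-trans (cong (λ t → 𝔼 (insertZig p x t) Φleft) (rotateUp-max [] A [] s<M))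
                   (cong (λ d → 𝔼 d Φleft) (insertZig-underMaxLeft [] A [] s<x)) ⟨
      𝔼 (insertZig p x (rotateUp M (node A s (node leaf M leaf)))) Φleft
        ∎
      where
      open ≤-Reasoning
      s<M = ℕ.<-trans s<x x<M
      a = Φleft (node A s leaf)
      T = node (node A s (node leaf x leaf)) M leaf
      unrotated : Φleft T ≡ 1ℚ + a
      unrotated = ℕtoℚ-suc (leftSpineLength (node A s leaf))
      x-rotated : Φleft (rotateUp x T) ≡ 1ℚ + (1ℚ + a)
      x-rotated = ≡-trans (cong Φleft (rotateUp-underMaxLeft [] A [] s<x))
                          (≡-trans (ℕtoℚ-suc (leftSpineLength T)) (cong (1ℚ +_) unrotated))
      s-rotated : Φleft (rotateUp s T) ≡ a
      s-rotated = cong Φleft (rotateUp-leftOfBottom [] A (node leaf x leaf) [] s<M)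

    𝔼-Φleft-insertPair : ∀ A₀ s₀ Z →
      IsBST (graft ((A₀ , s₀) ∷ Z) leaf) → AllKeys (_< x) (graft ((A₀ , s₀) ∷ Z) leaf) →
      Φleft (graft ((A₀ , s₀) ∷ Z) leaf) + (1ℚ - p) * p ^ length Z ≤
      𝔼 (insertPair p M x (graft ((A₀ , s₀) ∷ Z) leaf)) Φleft
    𝔼-Φleft-insertPair A₀ s₀ [] bst below = begin
      Φleft (node A₀ s₀ leaf) + (1ℚ - p) * 1ℚ
        ≤⟨ 𝔼-rebalanceZig-gain 0≤p p≤1 T′ {λ t → 𝔼 (insertZig p x t) Φleft} [] M s₀ []
             (Φleft-afterMaxRotation A₀ s₀<x)
             (Φleft-insertZig-mono A₀ _ s₀<x (IsBST-graft-max ((A₀ , s₀) ∷ []) (s₀<M ∷ []) bst)) ⟩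
      𝔼 (rebalanceZig p T′ (M ∷ s₀ ∷ [])) (λ t → 𝔼 (insertZig p x t) Φleft)
        ≡⟨ 𝔼-insertPair-max ((A₀ , s₀) ∷ []) Φleft (s₀<M ∷ []) ⟨
      𝔼 (insertPair p M x (node A₀ s₀ leaf)) Φleft
        ∎
      where
      open ≤-Reasoning
      T′ = node A₀ s₀ (node leaf M leaf)
      s₀<x = proj₁ (proj₂ below)
      s₀<M = ℕ.<-trans s₀<x x<M
    𝔼-Φleft-insertPair A₀ s₀ ((A₁ , s₁) ∷ Z) bst below = begin
      a + (1ℚ - p) * p ^ suc (length Z)
        ≡⟨ cong (λ k → a + (1ℚ - p) * p ^ suc k) (length-reverse-spineKeys Z) ⟨
      a + (1ℚ - p) * p ^ length vs
        ≤⟨ 𝔼-rebalanceZig-gain 0≤p p≤1 T′ {G} vs s₁ s₀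
             (All.map belowRotation (s₁<M ∷ All-reverse⁺ s₁<Z)) s₁-rotation
             (Φleft-insertZig-mono A₀ R′ s₀<x bst′) ⟩
      𝔼 (rebalanceZig p T′ (vs ++ s₁ ∷ s₀ ∷ [])) G
        ≡⟨ cong (λ path → 𝔼 (rebalanceZig p T′ (M ∷ path)) G) (reverse-++ (s₀ ∷ s₁ ∷ []) (spineKeys Z)) ⟨
      𝔼 (rebalanceZig p T′ (M ∷ reverse (s₀ ∷ s₁ ∷ spineKeys Z))) G
        ≡⟨ 𝔼-insertPair-max ((A₀ , s₀) ∷ (A₁ , s₁) ∷ Z) Φleft S<M ⟨
      𝔼 (insertPair p M x (graft ((A₀ , s₀) ∷ (A₁ , s₁) ∷ Z) leaf)) Φleft
        ∎
      where
      open ≤-Reasoning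
      a = Φleft (node A₀ s₀ leaf)
      G : Tree → ℚ
      G t = 𝔼 (insertZig p x t) Φleft
      R″ = graft Z (node leaf M leaf)
      R′ = node A₁ s₁ R″
      T′ = node A₀ s₀ R′
      vs = M ∷ reverse (spineKeys Z)
      S<x = AllKeys-graft ((A₀ , s₀) ∷ (A₁ , s₁) ∷ Z) leaf below
      S<M = All.map (λ k<x → ℕ.<-trans k<x x<M) S<x
      s₀<x = All.head S<x
      s₁<x = All.head (All.tail S<x)
      bst′ : IsBST T′
      bst′ = IsBST-graft-max ((A₀ , s₀) ∷ (A₁ , s₁) ∷ Z) S<M bst
      s₀<s₁ = proj₁ (proj₂ (proj₁ (proj₂ bst′)))
      s₁<R″ = proj₁ (proj₂ (proj₂ (proj₂ (proj₂ bst′))))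
      s₁<Z = AllKeys-graft Z _ s₁<R″
      s₁<M = proj₁ (proj₂ (AllKeys-graft-tail Z _ s₁<R″))
      belowRotation : ∀ {v} → s₁ < v → a ≤ G (rotateUp v T′)
      belowRotation {v} s₁<v = subst (λ t → a ≤ G t) (≡-sym rot)
        (Φleft-insertZig-mono A₀ (rotateUp v R′) s₀<x (subst IsBST rot (IsBST-rotateUp v T′ bst′)))
        where
        rot : rotateUp v T′ ≡ node A₀ s₀ (rotateUp v R′)
        rot = rotateUp-inRight A₀ R′ (ℕ.<-trans s₀<s₁ s₁<v) (ℕ.<⇒≢ s₁<v)
      s₁-rotation : a + 1ℚ ≤ G (rotateUp s₁ T′)
      s₁-rotation = subst₂ (λ b t → b ≤ G t)
        (≡-trans (ℕtoℚ-suc (leftSpineLength (node A₀ s₀ leaf))) (+-comm 1ℚ a)) (≡-sym rot)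
        (Φleft-insertZig-mono (node A₀ s₀ A₁) R″ s₁<x (subst IsBST rot (IsBST-rotateUp s₁ T′ bst′)))
        where
        rot : rotateUp s₁ T′ ≡ node (node A₀ s₀ A₁) s₁ R″
        rot = rotateUp-rightChild A₀ A₁ R″ s₀<s₁

open LeftSpineDrift


module BottomDrift where

  open import Data.Nat as ℕ using (ℕ; suc; _<_)
  import Data.Nat.Properties as ℕ
  open import Data.Rational using (ℚ; 0ℚ; _+_)
  open import Data.List using ([]; _∷_; reverse)
  open import Data.List.Relation.Unary.All as All using (All)
  open import Data.Product using (_,_; proj₁; proj₂)
  open import Relation.Binary.PropositionalEquality
    using (_≡_; refl; cong; subst; module ≡-Reasoning)
    renaming (sym to ≡-sym; trans to ≡-trans)

  Φbottom : Tree → ℚ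
  Φbottom t = ℕtoℚ (bottomLeftSpineLength t)

  module _ {x M : ℕ} (x<M : x < M) where
    open Pair 0ℚ x<M

    𝔼-Φbottom-insertPair-graft : ∀ S A s → AllKeys (_< x) (graft S (node A s leaf)) →
      𝔼 (insertPair 0ℚ M x (graft S (node A s leaf))) Φbottom ≡ Φbottom (graft S (node A s leaf)) + 2ℚ
    𝔼-Φbottom-insertPair-graft S A s below = begin
      𝔼 (insertPair 0ℚ M x (graft S (node A s leaf))) Φbottom
        ≡⟨ 𝔼-bind (insertZig 0ℚ M (graft S (node A s leaf))) (insertZig 0ℚ x) Φbottom ⟩
      𝔼 (insertZig 0ℚ M (graft S (node A s leaf))) G
        ≡⟨ cong (λ d → 𝔼 d G) (insertZig-max-below S A S<M s<M) ⟩
      𝔼 (rebalanceZig 0ℚ (graft S (node A s (node leaf M leaf))) (M ∷ s ∷ reverse (spineKeys S))) G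
        ≡⟨ 𝔼-rebalanceZig₀ (graft S (node A s (node leaf M leaf))) M s (reverse (spineKeys S)) G ⟩
      G (rotateUp M (graft S (node A s (node leaf M leaf))))
        ≡⟨ cong G (rotateUp-max S A S<M s<M) ⟩
      G (graft S (node (node A s leaf) M leaf))
        ≡⟨ cong (λ d → 𝔼 d Φbottom) (insertZig-underMaxLeft S A S<x s<x) ⟩
      𝔼 (rebalanceZig 0ℚ T₂ (x ∷ s ∷ M ∷ reverse (spineKeys S))) Φbottom
        ≡⟨ 𝔼-rebalanceZig₀ T₂ x s (M ∷ reverse (spineKeys S)) Φbottom ⟩
      Φbottom (rotateUp x T₂)
        ≡⟨ cong Φbottom (rotateUp-underMaxLeft S A S<x s<x) ⟩
      Φbottom (graft S (node (node (node A s leaf) x leaf) M leaf))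
        ≡⟨ cong ℕtoℚ (bottomLeftSpineLength-graft S _ M) ⟩
      ℕtoℚ (suc (suc (suc (leftSpineLength A))))
        ≡⟨ ≡-trans (cong ℕtoℚ (ℕ.+-comm 2 (suc (leftSpineLength A)))) (ℕtoℚ-+ (suc (leftSpineLength A)) 2) ⟩
      ℕtoℚ (suc (leftSpineLength A)) + 2ℚ
        ≡⟨ cong (λ n → ℕtoℚ n + 2ℚ) (bottomLeftSpineLength-graft S A s) ⟨
      Φbottom (graft S (node A s leaf)) + 2ℚ
        ∎
      where
      open ≡-Reasoning
      G : Tree → ℚ
      G t = 𝔼 (insertZig 0ℚ x t) Φbottom
      T₂ = graft S (node (node A s (node leaf x leaf)) M leaf)
      S<x = AllKeys-graft S _ below
      S<M = All.map (λ k<x → ℕ.<-trans k<x x<M) S<x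
      s<x = proj₁ (proj₂ (AllKeys-graft-tail S _ below))
      s<M = ℕ.<-trans s<x x<M

    𝔼-Φbottom-insertPair : ∀ A₀ s₀ Z → AllKeys (_< x) (graft ((A₀ , s₀) ∷ Z) leaf) →
      𝔼 (insertPair 0ℚ M x (graft ((A₀ , s₀) ∷ Z) leaf)) Φbottom ≡ Φbottom (graft ((A₀ , s₀) ∷ Z) leaf) + 2ℚ
    𝔼-Φbottom-insertPair A₀ s₀ Z below with snoc-view (A₀ , s₀) Z
    ... | S , (A , s) , split =
      subst (λ T → 𝔼 (insertPair 0ℚ M x T) Φbottom ≡ Φbottom T + 2ℚ) (≡-sym graft-split)
        (𝔼-Φbottom-insertPair-graft S A s (subst (AllKeys _) graft-split below))
      where
      graft-split : graft ((A₀ , s₀) ∷ Z) leaf ≡ graft S (node A s leaf)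
      graft-split = ≡-trans (cong (λ S′ → graft S′ leaf) split) (graft-++ S ((A , s) ∷ []) leaf)

open BottomDrift


module PairsProcess where

  open import Data.Nat as ℕ using (ℕ; zero; suc; _≤_; s≤s)
  import Data.Nat.Properties as ℕ
  open import Data.Rational as ℚ using (ℚ; 0ℚ; 1ℚ)
  open import Data.Rational.Properties using (nonNegative⁻¹)
  open import Data.List using (List; []; _∷_; _++_; [_]; upTo; concatMap)
  open import Data.List.Properties using (concatMap-++; applyUpTo-∷ʳ; ++-identityʳ)
  open import Data.List.Relation.Unary.All as All using (All; []; _∷_)
  open import Data.Product using (_×_; _,_)
  open import Data.Sum using (_⊎_; inj₁; inj₂)
  open import Data.Unit using (tt)
  open import Function using (id)
  open import Relation.Binary.PropositionalEquality
    using (_≡_; _≢_; refl; cong; subst; module ≡-Reasoning)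
    renaming (sym to ≡-sym; trans to ≡-trans)

  runZig : ℚ → Dist Tree → List ℕ → Dist Tree
  runZig p d []       = d
  runZig p d (x ∷ xs) = runZig p (bindDist d (insertZig p x)) xs

  runZig-unique : ∀ p (run : Dist Tree → List ℕ → Dist Tree) →
    (∀ d → run d [] ≡ d) → (∀ d x xs → run d (x ∷ xs) ≡ run (bindDist d (insertZig p x)) xs) →
    ∀ d xs → run d xs ≡ runZig p d xs
  runZig-unique p run run-[] run-∷ d []       = run-[] d
  runZig-unique p run run-[] run-∷ d (x ∷ xs) =
    ≡-trans (run-∷ d x xs) (runZig-unique p run run-[] run-∷ (bindDist d (insertZig p x)) xs)

  -- insertAllZig runs a local loop that cannot be named; abstracting its start distribution lets
  -- runZig-unique identify that loop with runZig.
  insertAllZig-runZig : ∀ p xs → insertAllZig p xs ≡ runZig p ((1ℚ , leaf) ∷ []) xs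
  insertAllZig-runZig p []       = refl
  insertAllZig-runZig p (x ∷ xs) = from-start x xs
    where
    from-start : ∀ x → (xs : List ℕ) → insertAllZig p (x ∷ xs) ≡ runZig p (bindDist ((1ℚ , leaf) ∷ []) (insertZig p x)) xs
    from-start x with bindDist ((1ℚ , leaf) ∷ []) (insertZig p x) | runZig-unique p _ (λ _ → refl) (λ _ _ _ → refl)
    ... | d | unique = unique d

  runZig-++ : ∀ p d xs ys → runZig p d (xs ++ ys) ≡ runZig p (runZig p d xs) ys
  runZig-++ p d []       ys = refl
  runZig-++ p d (x ∷ xs) ys = runZig-++ p (bindDist d (insertZig p x)) xs ys

  pairsSeq-suc : ∀ m → pairsSeq (suc m) ≡ pairsSeq m ++ (2 ℕ.+ 2 ℕ.* m) ∷ (1 ℕ.+ 2 ℕ.* m) ∷ []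
  pairsSeq-suc m = ≡-trans (cong (concatMap pair) (≡-sym (applyUpTo-∷ʳ id m)))
    (≡-trans (concatMap-++ pair (upTo m) [ m ]) (cong (pairsSeq m ++_) (++-identityʳ (pair m))))
    where
    pair : ℕ → List ℕ
    pair i = (2 ℕ.+ 2 ℕ.* i) ∷ (1 ℕ.+ 2 ℕ.* i) ∷ []

  pairsDist : ℚ → ℕ → Dist Tree
  pairsDist p m = insertAllZig p (pairsSeq m)

  pairsDist-suc : ∀ p m → pairsDist p (suc m) ≡
    bindDist (bindDist (pairsDist p m) (insertZig p (2 ℕ.+ 2 ℕ.* m))) (insertZig p (1 ℕ.+ 2 ℕ.* m))
  pairsDist-suc p m = begin
    insertAllZig p (pairsSeq (suc m))
      ≡⟨ insertAllZig-runZig p (pairsSeq (suc m)) ⟩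
    runZig p start (pairsSeq (suc m))
      ≡⟨ cong (runZig p start) (pairsSeq-suc m) ⟩
    runZig p start (pairsSeq m ++ _ ∷ _ ∷ [])
      ≡⟨ runZig-++ p start (pairsSeq m) _ ⟩
    runZig p (runZig p start (pairsSeq m)) (_ ∷ _ ∷ [])
      ≡⟨ cong (λ d → runZig p d ((2 ℕ.+ 2 ℕ.* m) ∷ (1 ℕ.+ 2 ℕ.* m) ∷ [])) (insertAllZig-runZig p (pairsSeq m)) ⟨
    bindDist (bindDist (pairsDist p m) (insertZig p (2 ℕ.+ 2 ℕ.* m))) (insertZig p (1 ℕ.+ 2 ℕ.* m))
      ∎
    where
    open ≡-Reasoning
    start = (1ℚ , leaf) ∷ []

  𝔼-pairsDist-suc : ∀ p m f →
    𝔼 (pairsDist p (suc m)) f ≡ 𝔼 (pairsDist p m) (λ t → 𝔼 (insertPair p (2 ℕ.+ 2 ℕ.* m) (1 ℕ.+ 2 ℕ.* m) t) f)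
  𝔼-pairsDist-suc p m f = begin
    𝔼 (pairsDist p (suc m)) f
      ≡⟨ cong (λ d → 𝔼 d f) (pairsDist-suc p m) ⟩
    𝔼 (bindDist (bindDist D (insertZig p M)) (insertZig p x)) f
      ≡⟨ 𝔼-bind (bindDist D (insertZig p M)) (insertZig p x) f ⟩
    𝔼 (bindDist D (insertZig p M)) (λ t → 𝔼 (insertZig p x t) f)
      ≡⟨ 𝔼-bind D (insertZig p M) _ ⟩
    𝔼 D (λ t → 𝔼 (insertZig p M t) (λ u → 𝔼 (insertZig p x u) f))
      ≡⟨ 𝔼-cong D (λ t → 𝔼-bind (insertZig p M t) (insertZig p x) f) ⟨
    𝔼 D (λ t → 𝔼 (insertPair p M x t) f)
      ∎
    where
    open ≡-Reasoning
    D = pairsDist p m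
    M = 2 ℕ.+ 2 ℕ.* m
    x = 1 ℕ.+ 2 ℕ.* m

  KeyedBST : (ℕ → Set) → ℕ → Tree → Set
  KeyedBST P n t = IsBST t × AllKeys P t × size t ≡ n

  KeyedBST-rotateUp : ∀ {P n} v t → KeyedBST P n t → KeyedBST P n (rotateUp v t)
  KeyedBST-rotateUp v t (bst , keys , |t|) = IsBST-rotateUp v t bst , AllKeys-rotateUp v t keys , ≡-trans (size-rotateUp v t) |t|

  KeyedBST-insert : ∀ {P Q : ℕ → Set} {n y} t → Q y → (∀ {k} → P k → Q k) → (∀ {k} → P k → k ≢ y) →
    KeyedBST P n t → KeyedBST Q (suc n) (insert y t)
  KeyedBST-insert t Qy P⇒Q P⇒≢y (bst , keys , |t|) =
    IsBST-insert _ t bst , AllKeys-insert t Qy (AllKeys-map P⇒Q t keys) ,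
    ≡-trans (size-insert _ t (AllKeys-map P⇒≢y t keys)) (cong suc |t|)

  Invariant : ℕ → Tree → Set
  Invariant i = KeyedBST (_≤ 2 ℕ.* i) (2 ℕ.* i)

  Invariant-spine : ∀ {P : Tree → Set} i t → Invariant (suc i) t →
    (∀ A₀ s₀ Z → IsBST (graft ((A₀ , s₀) ∷ Z) leaf) →
       AllKeys (ℕ._< 1 ℕ.+ 2 ℕ.* suc i) (graft ((A₀ , s₀) ∷ Z) leaf) →
       P (graft ((A₀ , s₀) ∷ Z) leaf)) →
    P t
  Invariant-spine {P} i (node A₀ s₀ r) (bst , keys , _) spine-case =
    subst P (graft-rightSpine (node A₀ s₀ r))
      (spine-case A₀ s₀ (rightSpine r) (subst IsBST (≡-sym (graft-rightSpine (node A₀ s₀ r))) bst)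
        (subst (AllKeys _) (≡-sym (graft-rightSpine (node A₀ s₀ r))) (AllKeys-map s≤s (node A₀ s₀ r) keys)))

  module _ (p : ℚ) (0≤p : 0ℚ ℚ.≤ p) (p≤1 : p ℚ.≤ 1ℚ) where
    open Walk p

    insertZig-ProbOn : ∀ {Q : Tree → Set} y t →
      (∀ v u → Q u → Q (rotateUp v u)) → Q (insert y t) → ProbOn Q (insertZig p y t)
    insertZig-ProbOn y t Q-rotateUp Q-insert =
      rebalanceZig-ProbOn 0≤p p≤1 _ _ Q-insert (All.universal (λ v → Q-rotateUp v _ Q-insert) _)

    pairsDist-ProbOn : ∀ m → ProbOn (Invariant m) (pairsDist p m)
    pairsDist-ProbOn zero    = (nonNegative⁻¹ 1ℚ , tt , tt , refl) ∷ [] , refl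
    pairsDist-ProbOn (suc m) = subst (ProbOn (Invariant (suc m))) (≡-sym (pairsDist-suc p m))
      (ProbOn-bind (ProbOn-bind (pairsDist-ProbOn m)
                     (λ t inv → insertZig-ProbOn (2 ℕ.+ 2 ℕ.* m) t KeyedBST-rotateUp (insertMax t inv)))
        (λ t inv → insertZig-ProbOn (1 ℕ.+ 2 ℕ.* m) t KeyedBST-rotateUp (insertSecond t inv)))
      where
      Old : ℕ → Set
      Old k = k ≤ 2 ℕ.* m ⊎ k ≡ 2 ℕ.+ 2 ℕ.* m
      2[1+m] : 2 ℕ.* suc m ≡ 2 ℕ.+ 2 ℕ.* m
      2[1+m] = ℕ.*-suc 2 m
      insertMax : ∀ t → Invariant m t → KeyedBST Old (suc (2 ℕ.* m)) (insert (2 ℕ.+ 2 ℕ.* m) t)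
      insertMax t = KeyedBST-insert t (inj₂ refl) inj₁ (λ k≤2m → ℕ.<⇒≢ (ℕ.≤-trans (ℕ.s≤s k≤2m) (ℕ.n≤1+n _)))
      insertSecond : ∀ t → KeyedBST Old (suc (2 ℕ.* m)) t → Invariant (suc m) (insert (1 ℕ.+ 2 ℕ.* m) t)
      insertSecond t inv = subst (λ n → KeyedBST (_≤ n) n (insert (1 ℕ.+ 2 ℕ.* m) t)) (≡-sym 2[1+m])
        (KeyedBST-insert t (ℕ.n≤1+n _) Old⇒≤ Old⇒≢ inv)
        where
        Old⇒≤ : ∀ {k} → Old k → k ≤ 2 ℕ.+ 2 ℕ.* m
        Old⇒≤ (inj₁ k≤2m) = ℕ.≤-trans k≤2m (ℕ.≤-trans (ℕ.n≤1+n _) (ℕ.n≤1+n _))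
        Old⇒≤ (inj₂ refl) = ℕ.≤-refl
        Old⇒≢ : ∀ {k} → Old k → k ≢ 1 ℕ.+ 2 ℕ.* m
        Old⇒≢ (inj₁ k≤2m) = ℕ.<⇒≢ (ℕ.s≤s k≤2m)
        Old⇒≢ (inj₂ refl) = ℕ.>⇒≢ (ℕ.n<1+n _)

open PairsProcess


module DriftToDepth where

  open import Data.Nat as ℕ using (ℕ; zero; suc; _≥_; s≤s)
  import Data.Nat.Properties as ℕ
  open import Data.Rational using (ℚ; 0ℚ; 1ℚ; ½; _+_; _*_; _-_; _≤_; _<_)
  open import Data.Rational.Properties
  open import Data.Rational.Solver using (module +-*-Solver)
  open import Data.List using (_∷_)
  open import Data.Product using (Σ; _×_; _,_; proj₁)
  open import Relation.Binary.PropositionalEquality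
    using (_≡_; refl; cong; cong₂; subst; subst₂; module ≡-Reasoning)
    renaming (sym to ≡-sym; trans to ≡-trans)
  open +-*-Solver

  record Potential (p c : ℚ) : Set where
    field
      Φ        : Tree → ℚ
      drift    : ∀ {x M} → x ℕ.< M → ∀ A₀ s₀ Z →
                 IsBST (graft ((A₀ , s₀) ∷ Z) leaf) → AllKeys (ℕ._< x) (graft ((A₀ , s₀) ∷ Z) leaf) →
                 Φ (graft ((A₀ , s₀) ∷ Z) leaf) + c ≤ 𝔼 (insertPair p M x (graft ((A₀ , s₀) ∷ Z) leaf)) Φ
      Φ≤height : ∀ t → Φ t ≤ ℕtoℚ (height t)
      initial  : ∀ t → Invariant 1 t → 0ℚ ≤ Φ t

  module _ {p c : ℚ} (0≤p : 0ℚ ≤ p) (p≤1 : p ≤ 1ℚ) (potential : Potential p c) where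
    open Potential potential

    Potential-growth : ∀ j → c * ℕtoℚ j ≤ 𝔼 (pairsDist p (suc j)) Φ
    Potential-growth zero    = subst (_≤ _) (≡-sym (*-zeroʳ c)) (𝔼-lowerBound 0ℚ (pairsDist-ProbOn p 0≤p p≤1 1) initial)
    Potential-growth (suc j) = begin
      c * ℕtoℚ (suc j)              ≡⟨ cong (c *_) (ℕtoℚ-suc j) ⟩
      c * (1ℚ + ℕtoℚ j)             ≡⟨ solve 2 (λ c n → c :* (con 1ℚ :+ n) := c :* n :+ c) refl c (ℕtoℚ j) ⟩
      c * ℕtoℚ j + c                ≤⟨ +-monoˡ-≤ c (Potential-growth j) ⟩
      𝔼 D Φ + c                     ≡⟨ cong (𝔼 D Φ +_) (𝔼-const prob c) ⟨
      𝔼 D Φ + 𝔼 D (λ _ → c)         ≡⟨ 𝔼-+ D Φ (λ _ → c) ⟨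
      𝔼 D (λ t → Φ t + c)           ≤⟨ 𝔼-mono (proj₁ prob) (λ t inv →
                                         Invariant-spine {Drifts} j t inv (drift (ℕ.n<1+n _))) ⟩
      𝔼 D (λ t → 𝔼 (step t) Φ)      ≡⟨ 𝔼-pairsDist-suc p (suc j) Φ ⟨
      𝔼 (pairsDist p (suc (suc j))) Φ ∎
      where
      open ≤-Reasoning
      D = pairsDist p (suc j)
      prob = pairsDist-ProbOn p 0≤p p≤1 (suc j)
      step = insertPair p (2 ℕ.+ 2 ℕ.* suc j) (1 ℕ.+ 2 ℕ.* suc j)
      Drifts : Tree → Set
      Drifts t = Φ t + c ≤ 𝔼 (step t) Φ

  depthSumℚ : Tree → ℚ
  depthSumℚ t = ℕtoℚ (depthSum t)

  heightℚ-square : ∀ t → ℕtoℚ (height t) * ℕtoℚ (height t) ≤ 2ℚ * depthSumℚ t + ℕtoℚ (height t)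
  heightℚ-square t = subst₂ _≤_
    (ℕtoℚ-* (height t) (height t))
    (≡-trans (ℕtoℚ-+ (2 ℕ.* depthSum t) (height t)) (cong (_+ ℕtoℚ (height t)) (ℕtoℚ-* 2 (depthSum t))))
    (ℕtoℚ-mono-≤ (height*height≤2*depthSum+height t))

  -- Half of D ≥ 1 plus half of D ≥ (H² - H)/2 ≥ y H - (y + ½)²/2, the tangent of H²/2 at H = y + ½.
  depthSum-tangent : ∀ {y φ H D} → 0ℚ ≤ y → φ ≤ H → H * H ≤ 2ℚ * D + H → 1ℚ ≤ D →
    y * ½ * φ + ½ * ½ * (2ℚ - (y + ½) * (y + ½)) ≤ D
  depthSum-tangent {y} {φ} {H} {D} 0≤y φ≤H H²≤2D+H 1≤D = ≤-by-nonNeg-gap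
    (½ * ½ * ((H - y - ½) * (H - y - ½) + 2ℚ * y * (H - φ) + (2ℚ * D + H - H * H) + (2ℚ * D - 2ℚ)))
    (solve 4 (λ y φ H D → D := y :* con ½ :* φ :+ con ½ :* con ½ :* (con 2ℚ :- (y :+ con ½) :* (y :+ con ½))
         :+ con ½ :* con ½ :* ((H :- y :- con ½) :* (H :- y :- con ½) :+ con 2ℚ :* y :* (H :- φ)
                                :+ (con 2ℚ :* D :+ H :- H :* H) :+ (con 2ℚ :* D :- con 2ℚ))) refl y φ H D)
    (*-nonNeg (*-nonNeg 0≤½ 0≤½)
      (+-nonNeg (+-nonNeg (+-nonNeg (square-nonNeg (H - y - ½)) (*-nonNeg (*-nonNeg 0≤2 0≤y) (p≤q⇒0≤q-p φ≤H)))
                          (p≤q⇒0≤q-p H²≤2D+H))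
                (p≤q⇒0≤q-p (subst (_≤ 2ℚ * D) (*-identityʳ 2ℚ) (*-monoˡ-≤-nonNeg′ 0≤2 1≤D)))))
    where
    0≤½ : 0ℚ ≤ ½
    0≤½ = nonNegative⁻¹ ½
    0≤2 : 0ℚ ≤ 2ℚ
    0≤2 = nonNegative⁻¹ 2ℚ

  𝔼-depthSum-lowerBound : ∀ {P d Φ y} → ProbOn P d →
    (∀ t → P t → 1 ℕ.≤ depthSum t) → (∀ t → Φ t ≤ ℕtoℚ (height t)) →
    0ℚ ≤ y → y ≤ 𝔼 d Φ → ½ * ½ * ½ * (y * y) ≤ 𝔼 d depthSumℚ
  𝔼-depthSum-lowerBound {d = d} {Φ} {y} prob 1≤D Φ≤H 0≤y y≤𝔼Φ = begin
    ½ * ½ * ½ * (y * y)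
      ≤⟨ ≤-by-nonNeg-gap (½ * ½ * ½ * ((y - 1ℚ) * (y - 1ℚ)) + ½ * ½ * ½ * ½ * (2ℚ + 2ℚ + 1ℚ))
           (solve 1 (λ y → y :* con ½ :* y :+ con ½ :* con ½ :* (con 2ℚ :- (y :+ con ½) :* (y :+ con ½))
                          := con ½ :* con ½ :* con ½ :* (y :* y)
                             :+ (con ½ :* con ½ :* con ½ :* ((y :- con 1ℚ) :* (y :- con 1ℚ))
                                 :+ con ½ :* con ½ :* con ½ :* con ½ :* (con 2ℚ :+ con 2ℚ :+ con 1ℚ))) refl y)
           (+-nonNeg (*-nonNeg (nonNegative⁻¹ (½ * ½ * ½)) (square-nonNeg (y - 1ℚ)))
                     (nonNegative⁻¹ (½ * ½ * ½ * ½ * (2ℚ + 2ℚ + 1ℚ)))) ⟩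
    y * ½ * y + κ
      ≤⟨ +-monoˡ-≤ κ (*-monoˡ-≤-nonNeg′ (*-nonNeg 0≤y (nonNegative⁻¹ ½)) y≤𝔼Φ) ⟩
    y * ½ * 𝔼 d Φ + κ
      ≡⟨ cong₂ _+_ (𝔼-*ˡ d (y * ½) Φ) (𝔼-const prob κ) ⟨
    𝔼 d (λ t → y * ½ * Φ t) + 𝔼 d (λ _ → κ)
      ≡⟨ 𝔼-+ d (λ t → y * ½ * Φ t) (λ _ → κ) ⟨
    𝔼 d (λ t → y * ½ * Φ t + κ)
      ≤⟨ 𝔼-mono (proj₁ prob) (λ t Pt →
           depthSum-tangent 0≤y (Φ≤H t) (heightℚ-square t) (ℕtoℚ-mono-≤ (1≤D t Pt))) ⟩
    𝔼 d depthSumℚ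
      ∎
    where
    open ≤-Reasoning
    κ = ½ * ½ * (2ℚ - (y + ½) * (y + ½))

  Θ-linear : (ℕ → ℚ) → Set
  Θ-linear f = Σ ℚ (λ c₁ → Σ ℚ (λ c₂ → Σ ℕ (λ N →
    0ℚ < c₁ × 0ℚ < c₂ ×
    ((m : ℕ) → m ≥ N → (c₁ * ℕtoℚ (2 ℕ.* m) ≤ f m × f m ≤ c₂ * ℕtoℚ (2 ℕ.* m))))))

  𝔼-avgDepth : ∀ d k → 𝔼 d (avgDepth (suc k)) ≡ 𝔼 d depthSumℚ * 1/[1+k] k
  𝔼-avgDepth d k = begin
    𝔼 d (λ t → depthSumℚ t * 1/[1+k] k)   ≡⟨ 𝔼-cong d (λ t → *-comm (depthSumℚ t) (1/[1+k] k)) ⟩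
    𝔼 d (λ t → 1/[1+k] k * depthSumℚ t)   ≡⟨ 𝔼-*ˡ d (1/[1+k] k) depthSumℚ ⟩
    1/[1+k] k * 𝔼 d depthSumℚ             ≡⟨ *-comm (1/[1+k] k) (𝔼 d depthSumℚ) ⟩
    𝔼 d depthSumℚ * 1/[1+k] k             ∎
    where open ≡-Reasoning

  -- From n ≥ 1 we get 2(1 + n) ≤ 4n, which turns the quadratic bound in n into one in the tree size 2(1 + n).
  size-square-arith : ∀ c {z} → 1ℚ ≤ z →
    c * c * ½ ^ 7 * (2ℚ * (1ℚ + z)) * (2ℚ * (1ℚ + z)) ≤ ½ * ½ * ½ * ((c * z) * (c * z))
  size-square-arith c {z} 1≤z = ≤-by-nonNeg-gap (c * c * (½ ^ 5) * ((z - 1ℚ) * ((2ℚ + 1ℚ) * z + 1ℚ)))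
    (solve 2 (λ c z → con ½ :* con ½ :* con ½ :* ((c :* z) :* (c :* z))
       := c :* c :* con (½ ^ 7) :* (con 2ℚ :* (con 1ℚ :+ z)) :* (con 2ℚ :* (con 1ℚ :+ z))
          :+ c :* c :* con (½ ^ 5) :* ((z :- con 1ℚ) :* ((con 2ℚ :+ con 1ℚ) :* z :+ con 1ℚ))) refl c z)
    (*-nonNeg (*-nonNeg (square-nonNeg c) (nonNegative⁻¹ (½ ^ 5)))
      (*-nonNeg (p≤q⇒0≤q-p 1≤z)
                (+-nonNeg (*-nonNeg (nonNegative⁻¹ (2ℚ + 1ℚ)) (≤-trans (nonNegative⁻¹ 1ℚ) 1≤z)) (nonNegative⁻¹ 1ℚ))))

  module _ {p c : ℚ} (0≤p : 0ℚ ≤ p) (p≤1 : p ≤ 1ℚ) (0<c : 0ℚ < c) (potential : Potential p c) where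
    open Potential potential

    Potential⇒Θ-linear : Θ-linear (expectedAvgDepthPairs p)
    Potential⇒Θ-linear = c * c * ½ ^ 7 , 1ℚ , 2 , *-pos (*-pos 0<c 0<c) (positive⁻¹ (½ ^ 7)) , positive⁻¹ 1ℚ , bounds
      where
      bounds : (m : ℕ) → m ≥ 2 →
        c * c * ½ ^ 7 * ℕtoℚ (2 ℕ.* m) ≤ expectedAvgDepthPairs p m × expectedAvgDepthPairs p m ≤ 1ℚ * ℕtoℚ (2 ℕ.* m)
      bounds (suc n) (s≤s 1≤n) =
        subst (c * c * ½ ^ 7 * T ≤_) (≡-sym avg) (a*T≤b⇒a≤b*w (1/[1+k]-nonNeg k) (1/[1+k]*[1+k]≡1 k) lower) ,
        subst (_≤ 1ℚ * T) (≡-sym avg) (b≤a*T⇒b*w≤a (1/[1+k]-nonNeg k) (1/[1+k]*[1+k]≡1 k) upper)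
        where
        k = n ℕ.+ suc (n ℕ.+ 0)
        T = ℕtoℚ (2 ℕ.* suc n)
        D = pairsDist p (suc n)
        prob = pairsDist-ProbOn p 0≤p p≤1 (suc n)
        avg : expectedAvgDepthPairs p (suc n) ≡ 𝔼 D depthSumℚ * 1/[1+k] k
        avg = 𝔼-avgDepth D k
        T≡2[1+n] : T ≡ 2ℚ * (1ℚ + ℕtoℚ n)
        T≡2[1+n] = ≡-trans (ℕtoℚ-* 2 (suc n)) (cong (2ℚ *_) (ℕtoℚ-suc n))
        y = c * ℕtoℚ n
        lower : c * c * ½ ^ 7 * T * T ≤ 𝔼 D depthSumℚ
        lower = begin
          c * c * ½ ^ 7 * T * T
            ≡⟨ cong (λ T → c * c * ½ ^ 7 * T * T) T≡2[1+n] ⟩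
          c * c * ½ ^ 7 * (2ℚ * (1ℚ + ℕtoℚ n)) * (2ℚ * (1ℚ + ℕtoℚ n))
            ≤⟨ size-square-arith c (ℕtoℚ-mono-≤ 1≤n) ⟩
          ½ * ½ * ½ * (y * y)
            ≤⟨ 𝔼-depthSum-lowerBound prob
                 (λ t (_ , _ , |t|) → 1≤depthSum t (subst (2 ℕ.≤_) (≡-sym |t|) (ℕ.m≤m*n 2 (suc n))))
                 Φ≤height (*-nonNeg (<⇒≤ 0<c) (ℕtoℚ-nonNeg n)) (Potential-growth 0≤p p≤1 potential n) ⟩
          𝔼 D depthSumℚ
            ∎
          where open ≤-Reasoning
        upper : 𝔼 D depthSumℚ ≤ 1ℚ * T * T
        upper = begin
          𝔼 D depthSumℚ          ≤⟨ 𝔼-mono (proj₁ prob) (λ t (_ , _ , |t|) →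
                                       subst (λ s → depthSumℚ t ≤ ℕtoℚ s) (cong (λ s → s ℕ.* s) |t|)
                                         (ℕtoℚ-mono-≤ (depthSum≤size*size t))) ⟩
          𝔼 D (λ _ → ℕtoℚ (2 ℕ.* suc n ℕ.* (2 ℕ.* suc n)))
                                 ≡⟨ 𝔼-const prob _ ⟩
          ℕtoℚ (2 ℕ.* suc n ℕ.* (2 ℕ.* suc n))
                                 ≡⟨ ≡-trans (ℕtoℚ-* (2 ℕ.* suc n) (2 ℕ.* suc n)) (cong (_* T) (≡-sym (*-identityˡ T))) ⟩
          1ℚ * T * T             ∎
          where open ≤-Reasoning

open DriftToDepth


module Potentials where

  open import Data.Nat as ℕ using (ℕ; zero; suc; _<_)
  import Data.Nat.Properties as ℕ
  open import Data.Rational as ℚ using (ℚ; 0ℚ; 1ℚ; ½; _+_; _*_; _-_; -_; _≤_; _<?_)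
  open import Data.Rational.Properties
  open import Data.Rational.Solver using (module +-*-Solver)
  open import Data.List using (_∷_; length)
  open import Data.Product using (_,_)
  open import Data.Unit using (tt)
  open import Relation.Nullary.Decidable using (toWitness)
  open import Relation.Binary.PropositionalEquality
    using (_≡_; refl; cong; subst; module ≡-Reasoning)
    renaming (sym to ≡-sym; trans to ≡-trans)
  open +-*-Solver

  spinePotential : ∀ {p c} → 0ℚ ≤ p → p ≤ 1ℚ → (∀ k → c ≤ spineDrift p (p ^ suc k)) → Potential p c
  spinePotential {p} {c} 0≤p p≤1 c≤drift = record
    { Φ        = Φright
    ; drift    = λ x<M A₀ s₀ Z bst below →
                   subst (Φright (graft ((A₀ , s₀) ∷ Z) leaf) + c ≤_)
                     (≡-sym (𝔼-Φright-insertPair p x<M A₀ s₀ Z bst below))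
                     (+-monoʳ-≤ (Φright (graft ((A₀ , s₀) ∷ Z) leaf)) (c≤drift (length Z)))
    ; Φ≤height = λ t → ℕtoℚ-mono-≤ (rightSpineLength≤height t)
    ; initial  = λ t _ → ℕtoℚ-nonNeg (rightSpineLength t)
    }

  bottomPotential : Potential 0ℚ 2ℚ
  bottomPotential = record
    { Φ        = Φbottom
    ; drift    = λ x<M A₀ s₀ Z _ below → ≤-reflexive (≡-sym (𝔼-Φbottom-insertPair x<M A₀ s₀ Z below))
    ; Φ≤height = λ t → ℕtoℚ-mono-≤ (bottomLeftSpineLength≤height t)
    ; initial  = λ t _ → ℕtoℚ-nonNeg (bottomLeftSpineLength t)
    }

  module _ (p : ℚ) (0≤p : 0ℚ ≤ p) (p≤1 : p ≤ 1ℚ) where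

    -- For p > ½ a long right spine shrinks on average, so subtracting it gains; the weight (1 - p)/2 is small
    -- enough for the left-spine gain (1 - p) p^k to absorb the growth of short right spines.
    β : ℚ
    β = (1ℚ - p) * ½

    Φmixed : Tree → ℚ
    Φmixed t = Φleft t - β * Φright t

    mixedDrift : ℚ
    mixedDrift = β * p * (2ℚ * p - 1ℚ) * (2ℚ - p)

    mixedDrift-lowerBound : ∀ {P} → 0ℚ ≤ P → mixedDrift ≤ (1ℚ - p) * P - β * spineDrift p (p * P)
    mixedDrift-lowerBound {P} 0≤P = ≤-by-nonNeg-gap
      ((1ℚ - p) * (1ℚ - p) * P + (1ℚ - p) * (1ℚ - p) * (1ℚ - p) * ½ * (p * P) + β * (1ℚ - p) * ((p * P) * (p * P)))
      (solve 2 (λ p P → (con 1ℚ :- p) :* P :- (con 1ℚ :- p) :* con ½ :* (p :* (con 1ℚ :- con 2ℚ :* p) :* (con 2ℚ :- p)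
                           :+ (con 1ℚ :+ con 2ℚ :* p :- p :* p) :* (p :* P) :- (con 1ℚ :- p) :* ((p :* P) :* (p :* P)))
                      := (con 1ℚ :- p) :* con ½ :* p :* (con 2ℚ :* p :- con 1ℚ) :* (con 2ℚ :- p)
                         :+ ((con 1ℚ :- p) :* (con 1ℚ :- p) :* P
                             :+ (con 1ℚ :- p) :* (con 1ℚ :- p) :* (con 1ℚ :- p) :* con ½ :* (p :* P)
                             :+ (con 1ℚ :- p) :* con ½ :* (con 1ℚ :- p) :* ((p :* P) :* (p :* P))))
         refl p P)
      (+-nonNeg (+-nonNeg (*-nonNeg (*-nonNeg 0≤1-p 0≤1-p) 0≤P)
                          (*-nonNeg (*-nonNeg (*-nonNeg (*-nonNeg 0≤1-p 0≤1-p) 0≤1-p) (nonNegative⁻¹ ½)) (*-nonNeg 0≤p 0≤P)))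
                (*-nonNeg (*-nonNeg 0≤β 0≤1-p) (square-nonNeg (p * P))))
      where
      0≤1-p = p≤q⇒0≤q-p p≤1
      0≤β = *-nonNeg 0≤1-p (nonNegative⁻¹ ½)

    mixedPotential : Potential p mixedDrift
    mixedPotential = record
      { Φ        = Φmixed
      ; drift    = drift
      ; Φ≤height = λ t → ≤-trans (Φmixed≤Φleft t) (ℕtoℚ-mono-≤ (leftSpineLength≤height t))
      ; initial  = initial
      }
      where
      0≤β = *-nonNeg (p≤q⇒0≤q-p p≤1) (nonNegative⁻¹ ½)
      Φmixed≤Φleft : ∀ t → Φmixed t ≤ Φleft t
      Φmixed≤Φleft t = ≤-by-nonNeg-gap (β * Φright t)
        (solve 3 (λ a b s → a := a :- b :* s :+ b :* s) refl (Φleft t) β (Φright t))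
        (*-nonNeg 0≤β (ℕtoℚ-nonNeg (rightSpineLength t)))
      drift : ∀ {x M} → x < M → ∀ A₀ s₀ Z →
        IsBST (graft ((A₀ , s₀) ∷ Z) leaf) → AllKeys (ℕ._< x) (graft ((A₀ , s₀) ∷ Z) leaf) →
        Φmixed (graft ((A₀ , s₀) ∷ Z) leaf) + mixedDrift ≤ 𝔼 (insertPair p M x (graft ((A₀ , s₀) ∷ Z) leaf)) Φmixed
      drift {x} {M} x<M A₀ s₀ Z bst below = begin
        Φmixed T + mixedDrift
          ≤⟨ +-monoʳ-≤ (Φmixed T) (mixedDrift-lowerBound (^-nonNeg 0≤p (length Z))) ⟩
        Φmixed T + ((1ℚ - p) * P - β * spineDrift p (p * P))
          ≡⟨ solve 5 (λ a b β g s → (a :- β :* b) :+ (g :- β :* s) := (a :+ g) :- β :* (b :+ s))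
                     refl (Φleft T) (Φright T) β ((1ℚ - p) * P) (spineDrift p (p * P)) ⟩
        (Φleft T + (1ℚ - p) * P) - β * (Φright T + spineDrift p (p * P))
          ≤⟨ +-monoˡ-≤ _ (𝔼-Φleft-insertPair p 0≤p p≤1 x<M A₀ s₀ Z bst below) ⟩
        𝔼 D Φleft - β * (Φright T + spineDrift p (p * P))
          ≡⟨ cong (λ e → 𝔼 D Φleft - β * e) (𝔼-Φright-insertPair p x<M A₀ s₀ Z bst below) ⟨
        𝔼 D Φleft - β * 𝔼 D Φright
          ≡⟨ 𝔼-linear D Φleft β Φright ⟨
        𝔼 D Φmixed
          ∎
        where
        open ≤-Reasoning
        T = graft ((A₀ , s₀) ∷ Z) leaf
        D = insertPair p M x T
        P = p ^ length Z
      initial : ∀ t → Invariant 1 t → 0ℚ ≤ Φmixed t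
      initial t@(node l k r) (_ , _ , |t|) = begin
        0ℚ            ≤⟨ 0≤p ⟩
        p             ≡⟨ solve 1 (λ p → p := con 1ℚ :- (con 1ℚ :- p) :* con ½ :* con 2ℚ) refl p ⟩
        1ℚ - β * 2ℚ   ≤⟨ +-mono-≤ (ℕtoℚ-mono-≤ (ℕ.s≤s (ℕ.z≤n {leftSpineLength l})))
                                  (neg-antimono-≤ (*-monoˡ-≤-nonNeg′ 0≤β spine≤2)) ⟩
        Φmixed t      ∎
        where
        open ≤-Reasoning
        spine≤2 : Φright t ≤ 2ℚ
        spine≤2 = ℕtoℚ-mono-≤
          (subst (rightSpineLength t ℕ.≤_) |t| (ℕ.≤-trans (rightSpineLength≤height t) (height≤size t)))

  ½<1 : ½ ℚ.< 1ℚ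
  ½<1 = toWitness {a? = ½ <? 1ℚ} tt

  1<2 : 1ℚ ℚ.< 2ℚ
  1<2 = toWitness {a? = 1ℚ <? 2ℚ} tt

  1^k≡1 : ∀ k → 1ℚ ^ k ≡ 1ℚ
  1^k≡1 zero    = refl
  1^k≡1 (suc k) = cong (1ℚ *_) (1^k≡1 k)

  Θ-linear-p≡0 : Θ-linear (expectedAvgDepthPairs 0ℚ)
  Θ-linear-p≡0 = Potential⇒Θ-linear ≤-refl (nonNegative⁻¹ 1ℚ) (positive⁻¹ 2ℚ) bottomPotential

  Θ-linear-0<p<½ : ∀ {p} → 0ℚ ℚ.< p → p ℚ.< ½ → Θ-linear (expectedAvgDepthPairs p)
  Θ-linear-0<p<½ {p} 0<p p<½ = Potential⇒Θ-linear 0≤p p≤1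
    (*-pos (*-pos 0<p (p<q⇒0<q-p 2p<1)) (p<q⇒0<q-p (≤-<-trans p≤1 1<2)))
    (spinePotential 0≤p p≤1 (λ k → spineDrift-lowerBound 0≤p p≤1 (^-nonNeg 0≤p (suc k)) (^-≤1 0≤p p≤1 (suc k))))
    where
    0≤p = <⇒≤ 0<p
    p≤1 = <⇒≤ (<-trans p<½ ½<1)
    2p<1 : 2ℚ * p ℚ.< 1ℚ
    2p<1 = *-monoʳ-<-pos 2ℚ p<½

  Θ-linear-½<p<1 : ∀ {p} → ½ ℚ.< p → p ℚ.< 1ℚ → Θ-linear (expectedAvgDepthPairs p)
  Θ-linear-½<p<1 {p} ½<p p<1 = Potential⇒Θ-linear 0≤p p≤1
    (*-pos (*-pos (*-pos (*-pos (p<q⇒0<q-p p<1) (positive⁻¹ ½)) 0<p) (p<q⇒0<q-p 1<2p)) (p<q⇒0<q-p (≤-<-trans p≤1 1<2)))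
    (mixedPotential p 0≤p p≤1)
    where
    0<p = <-trans (positive⁻¹ ½) ½<p
    0≤p = <⇒≤ 0<p
    p≤1 = <⇒≤ p<1
    1<2p : 1ℚ ℚ.< 2ℚ * p
    1<2p = *-monoʳ-<-pos 2ℚ ½<p

  Θ-linear-p≡1 : Θ-linear (expectedAvgDepthPairs 1ℚ)
  Θ-linear-p≡1 = Potential⇒Θ-linear (nonNegative⁻¹ 1ℚ) ≤-refl (positive⁻¹ 1ℚ)
    (spinePotential (nonNegative⁻¹ 1ℚ) ≤-refl (λ k → ≤-reflexive (≡-sym (cong (spineDrift 1ℚ) (1^k≡1 (suc k))))))

open Potentials

open import Data.Nat using (ℕ; _≥_)
open import Data.Rational using (ℚ; _≤_; _<_; _*_; 0ℚ; 1ℚ; ½)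
open import Data.Rational.Properties using (<-cmp; <-irrefl; ≤-<-trans; <-≤-trans)
open import Data.Product using (Σ; _×_; _,_)
open import Data.Sum using (_⊎_; inj₁; inj₂)
open import Data.Empty using (⊥-elim)
open import Relation.Binary.Definitions using (tri<; tri≈; tri>)
open import Relation.Binary.PropositionalEquality using (refl)

theorem4 : (p : ℚ) → ((0ℚ ≤ p × p < ½) ⊎ (½ < p × p ≤ 1ℚ)) →
    Σ ℚ (λ c₁ → Σ ℚ (λ c₂ → Σ ℕ (λ N →
      0ℚ < c₁ × 0ℚ < c₂ ×
      ((m : ℕ) → m ≥ N →
        (c₁ * ℕtoℚ (2 Data.Nat.* m) ≤ expectedAvgDepthPairs p m
         × expectedAvgDepthPairs p m ≤ c₂ * ℕtoℚ (2 Data.Nat.* m))))))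
theorem4 p (inj₁ (0≤p , p<½)) with <-cmp 0ℚ p
... | tri< 0<p _ _  = Θ-linear-0<p<½ 0<p p<½
... | tri≈ _ refl _ = Θ-linear-p≡0
... | tri> _ _ p<0  = ⊥-elim (<-irrefl refl (≤-<-trans 0≤p p<0))
theorem4 p (inj₂ (½<p , p≤1)) with <-cmp p 1ℚ
... | tri< p<1 _ _  = Θ-linear-½<p<1 ½<p p<1
... | tri≈ _ refl _ = Θ-linear-p≡1
... | tri> _ _ 1<p  = ⊥-elim (<-irrefl refl (<-≤-trans 1<p p≤1))
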